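{- Let $\Lambda=\{132,213\}$. Then $$\sum_{n\ge 0}\overline{q}_n(\Lambda)\,x^n=\frac{(1-x)^2}{1-3x+x^3}$$ as formal power series, where $\overline{q}_0(\Lambda)=1$.
   Context: For a positive integer $n$, let $\mathcal{S}_{n,n}$ denote the set of all permutations (words) $\pi=\pi_1\cdots\pi_{2n}$ of the multiset $\{1,1,2,2,\ldots,n,n\}$. A word $\pi$ contains a pattern $\sigma=\sigma_1\cdots\sigma_k$ if there are indices $i_1<\cdots<i_k$ such that $\pi_{i_a}=\pi_{i_b}$ iff $\sigma_a=\sigma_b$ and $\pi_{i_a}<\pi_{i_b}$ iff $\sigma_a<\sigma_b$ for all $a,b$; otherwise $\pi$ avoids $\sigma$. The quasi-Stirling permutations $\overline{\mathcal{Q}}_n$ are the $\pi\in\mathcal{S}_{n,n}$ avoiding both $1212$ and $2121$. For a set $\Lambda$ of patterns, $\overline{\mathcal{Q}}_n(\Lambda)$ is the set of $\pi\in\overline{\mathcal{Q}}_n$ avoiding every pattern in $\Lambda$, and $\overline{q}_n(\Lambda)=|\overline{\mathcal{Q}}_n(\Lambda)|$; by convention $\overline{q}_0(\Lambda)=1$ (the empty word). -}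

module Defs where

open import Data.Bool using (Bool; true; false; _∧_; if_then_else_)
open import Data.Bool.Properties using () renaming (_≟_ to _≟ᵇ_)
open import Data.Nat using (ℕ; zero; suc; _+_; _*_; _∸_; _≡ᵇ_; _<ᵇ_)
open import Data.List using (List; []; _∷_; [_]; length; map; concatMap; filter; zip; upTo)
open import Data.Product using (_,_; proj₁; proj₂; _×_)
open import Data.Integer using (ℤ; +_; -_) renaming (_+_ to _+ℤ_; _*_ to _*ℤ_)
open import Relation.Nullary.Decidable using (⌊_⌋)
open import Relation.Binary.PropositionalEquality using (_≡_)

_==ᵇ_ : Bool → Bool → Bool
a ==ᵇ b = ⌊ a ≟ᵇ b ⌋

alphabet : ℕ → List ℕ
alphabet n = map suc (upTo n)

allWords : ℕ → ℕ → List (List ℕ)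
allWords n zero    = [ [] ]
allWords n (suc m) = concatMap (λ w → map (λ a → a ∷ w) (alphabet n)) (allWords n m)

count : ℕ → List ℕ → ℕ
count v []       = 0
count v (x ∷ xs) = if v ≡ᵇ x then suc (count v xs) else count v xs

subseqs : List ℕ → List (List ℕ)
subseqs []       = [ [] ]
subseqs (x ∷ xs) = let r = subseqs xs in map (x ∷_) r Data.List.++ r

allᵇ : {A : Set} → (A → Bool) → List A → Bool
allᵇ p []       = true
allᵇ p (x ∷ xs) = if p x then allᵇ p xs else false

anyᵇ : {A : Set} → (A → Bool) → List A → Bool
anyᵇ p []       = false
anyᵇ p (x ∷ xs) = if p x then true else anyᵇ p xs

orderIso : List ℕ → List ℕ → Bool
orderIso τ σ =
  (length τ ≡ᵇ length σ) ∧
  allᵇ (λ p → allᵇ (λ q →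
        ((proj₁ p ≡ᵇ proj₁ q) ==ᵇ (proj₂ p ≡ᵇ proj₂ q)) ∧
        ((proj₁ p <ᵇ proj₁ q) ==ᵇ (proj₂ p <ᵇ proj₂ q))) (zip τ σ)) (zip τ σ)

contains : List ℕ → List ℕ → Bool
contains π σ = anyᵇ (λ τ → orderIso τ σ) (subseqs π)

avoids : List ℕ → List ℕ → Bool
avoids π σ = if contains π σ then false else true

avoidsAll : List ℕ → List (List ℕ) → Bool
avoidsAll π Λ = allᵇ (avoids π) Λ

inSnn : ℕ → List ℕ → Bool
inSnn n π = (length π ≡ᵇ 2 * n) ∧ allᵇ (λ v → count v π ≡ᵇ 2) (alphabet n)

inQbar : ℕ → List (List ℕ) → List ℕ → Bool
inQbar n Λ π = inSnn n π ∧ avoidsAll π ((1 ∷ 2 ∷ 1 ∷ 2 ∷ []) ∷ (2 ∷ 1 ∷ 2 ∷ 1 ∷ []) ∷ Λ)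

-- q̄_n(Λ) = |Q̄_n(Λ)|, counted by enumerating all words of length 2n over {1..n}
-- (every element of S_{n,n} is such a word; for n = 0 this gives 1, the empty word)
qbar : List (List ℕ) → ℕ → ℕ
qbar Λ n = length (filter (λ π → inQbar n Λ π Data.Bool.≟ true) (allWords n (2 * n)))

-- Formal power series over ℤ as coefficient sequences; Cauchy product
Series : Set
Series = ℕ → ℤ

sumℤ : List ℤ → ℤ
sumℤ []       = + 0
sumℤ (x ∷ xs) = x +ℤ sumℤ xs

_⊛_ : Series → Series → Series
(f ⊛ g) n = sumℤ (map (λ k → f k *ℤ g (n ∸ k)) (upTo (suc n)))

den : Series
den 0 = + 1
den 1 = - (+ 3)
den 3 = + 1
den _ = + 0

num : Series
num 0 = + 1
num 1 = - (+ 2)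
num 2 = + 1
num _ = + 0

Λ₄₆ : List (List ℕ)
Λ₄₆ = (1 ∷ 3 ∷ 2 ∷ []) ∷ (2 ∷ 1 ∷ 3 ∷ []) ∷ []

-- Write a word of Q̄ₙ(Λ) as P n Q n R around the two copies of its largest letter n.
-- An occurrence of 1212, 2121, 132 or 213 that uses n uses it as its largest letter, so the
-- word avoids them iff P Q R does and either Q is empty, P is weakly increasing and P ≥ R,
-- or P is empty, Q is weakly increasing and Q > R. Splitting a word as F S, where F is its
-- first weakly increasing run (which dominates S), the words therefore form a generating
-- tree with three kinds of nodes: pair (F = m m), strict (F > S) and tied (some letter of F
-- reappears in S), having 4, 3 and 2 children respectively. The node counts (a, b, c) evolve
-- by (a, b, c) ↦ (a + b + c, a + b, 2a + b + c), whose totals satisfy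
-- T(k) + T(k + 3) = 3 T(k + 2); with q̄₀, …, q̄₃ = 1, 1, 4, 11 this is the identity
-- (Σ q̄ₙ xⁿ)(1 − 3x + x³) = (1 − x)².

module Submission where

open import Defs
open import Data.Bool using (Bool; true; false; T; _∧_)
import Data.Bool as Bool
open import Data.Bool.Properties using (T-≡)
open import Data.Empty using (⊥; ⊥-elim)
open import Data.Integer using (ℤ; +_; -_) renaming (_+_ to _+ℤ_; _*_ to _*ℤ_)
import Data.Integer.Properties as ℤ
import Data.Integer.Tactic.RingSolver as ℤ-Solver
open import Data.List
  using (List; []; _∷_; [_]; _++_; length; map; zip; concatMap; filter; upTo)
open import Data.List.Membership.Propositional using (_∈_; find; lose)
open import Data.List.Membership.Propositional.Properties
  using ( ∈-map⁻; ∈-map⁺; ∈-++⁺ˡ; ∈-++⁺ʳ; ∈-++⁻; ∈-concatMap⁺; ∈-concatMap⁻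
        ; ∈-upTo⁺; ∈-upTo⁻; ∈-filter⁺; ∈-filter⁻)
open import Data.List.Membership.Propositional.Properties.WithK using (unique∧set⇒bag)
open import Data.List.Properties
  using ( length-map; length-++-sucʳ; ++-assoc; ++-identityʳ; ∷-injective; map-++; map-id
        ; filter-++; filter-all; filter-reject; upTo-∷ʳ)
open import Data.List.Relation.Binary.BagAndSetEquality using (∼bag⇒↭)
open import Data.List.Relation.Binary.Permutation.Propositional.Properties using (↭-length)
open import Data.List.Relation.Binary.Sublist.Propositional
  using (_⊆_; []; _∷_; _∷ʳ_; ⊆-refl; ⊆-trans; from∈; to∈; lookup; minimum)
open import Data.List.Relation.Binary.Sublist.Propositional.Properties
  using (++⁺; ++⁺ˡ; ++⁺ʳ; All-resp-⊆)
open import Data.List.Relation.Unary.All using (All; []; _∷_; all?)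
import Data.List.Relation.Unary.All as All
open import Data.List.Relation.Unary.All.Properties
  using () renaming (++⁺ to All-++⁺; ++⁻ˡ to All-++⁻ˡ; ++⁻ʳ to All-++⁻ʳ)
open import Data.List.Relation.Unary.AllPairs using (AllPairs; []; _∷_)
open import Data.List.Relation.Unary.Any using (here; there)
open import Data.List.Relation.Unary.Unique.Propositional using (Unique)
import Data.List.Relation.Unary.Unique.Propositional.Properties as Unique
open import Data.Nat
  using ( ℕ; zero; suc; pred; _+_; _*_; _∸_; _<_; _≤_; _≟_; _≤?_; _≡ᵇ_; _<ᵇ_
        ; z≤n; s≤s; s≤s⁻¹; z<s; s<s)
open import Data.Nat.Properties
  using ( ≡ᵇ⇒≡; ≡⇒≡ᵇ; <ᵇ⇒<; <⇒<ᵇ; <-cmp; <-irrefl; <-asym; <-trans; <⇒≢; >⇒≢; <⇒≤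
        ; ≤-refl; ≤-trans; <-≤-trans; ≤⇒≯; ≤-antisym; ≤∧≢⇒<; m<n⇒m<1+n; n<1+n
        ; suc-injective; +-assoc; *-suc; m+n∸n≡m; n∸n≡0)
open import Data.Nat.Tactic.RingSolver using (solve-∀)
open import Data.Product using (∃-syntax; _×_; _,_; proj₁; proj₂)
open import Data.Sum using (_⊎_; inj₁; inj₂)
open import Data.Unit using (⊤; tt)
open import Function using (id; _∘_; case_of_; Equivalence; _⇔_; mk⇔)
open import Relation.Binary using (tri<; tri≈; tri>)
open import Relation.Binary.PropositionalEquality
  using (_≡_; _≢_; refl; sym; trans; cong; cong₂; subst; module ≡-Reasoning)
open import Relation.Nullary using (¬_; ¬?; yes; no)
open import Relation.Nullary.Decidable using (True; toWitness; _×-dec_)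

open ≡-Reasoning

pattern ∈₀ = here refl
pattern ∈₁ = there ∈₀
pattern ∈₂ = there ∈₁
pattern ∈₃ = there ∈₂

T⇒≡true : ∀ {b} → T b → b ≡ true
T⇒≡true = Equivalence.to T-≡

≡true⇒T : ∀ {b} → b ≡ true → T b
≡true⇒T = Equivalence.from T-≡

¬T⇒≡false : ∀ {b} → ¬ T b → b ≡ false
¬T⇒≡false {false} _ = refl
¬T⇒≡false {true}  ¬t = ⊥-elim (¬t _)

==ᵇ⇒≡ : ∀ {x y} → (x ==ᵇ y) ≡ true → x ≡ y
==ᵇ⇒≡ {false} {false} _ = refl
==ᵇ⇒≡ {true}  {true}  _ = refl

==ᵇ-refl : ∀ x → (x ==ᵇ x) ≡ true
==ᵇ-refl false = refl
==ᵇ-refl true  = refl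

∧-≡true : ∀ {x y} → (x ∧ y) ≡ true → x ≡ true × y ≡ true
∧-≡true {true} e = refl , e

allᵇ-∈ : ∀ {A : Set} {p : A → Bool} {xs x} → allᵇ p xs ≡ true → x ∈ xs → p x ≡ true
allᵇ-∈ {p = p} {y ∷ _} h ∈₀ with p y
... | true  = refl
... | false = h
allᵇ-∈ {p = p} {y ∷ _} h (there x∈xs) with p y
... | true  = allᵇ-∈ h x∈xs
... | false = ⊥-elim (case h of λ ())

allᵇ-intro : ∀ {A : Set} {p : A → Bool} xs → (∀ {x} → x ∈ xs → p x ≡ true) → allᵇ p xs ≡ true
allᵇ-intro []       _ = refl
allᵇ-intro (x ∷ xs) h rewrite h ∈₀ = allᵇ-intro xs (h ∘ there)

anyᵇ-intro : ∀ {A : Set} {p : A → Bool} {xs x} → x ∈ xs → p x ≡ true → anyᵇ p xs ≡ true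
anyᵇ-intro ∈₀ px rewrite px = refl
anyᵇ-intro {p = p} {y ∷ _} (there x∈xs) px with p y
... | true  = refl
... | false = anyᵇ-intro x∈xs px

anyᵇ-elim : ∀ {A : Set} {p : A → Bool} xs → anyᵇ p xs ≡ true → ∃[ x ] x ∈ xs × p x ≡ true
anyᵇ-elim {p = p} (y ∷ xs) h with p y in py
... | true  = y , ∈₀ , py
... | false = let x , x∈xs , px = anyᵇ-elim xs h in x , there x∈xs , px

≡ᵇ-≡ : ∀ {m n} → m ≡ n → (m ≡ᵇ n) ≡ true
≡ᵇ-≡ {m} {n} m≡n = T⇒≡true (≡⇒≡ᵇ m n m≡n)

≡ᵇ-≢ : ∀ {m n} → m ≢ n → (m ≡ᵇ n) ≡ false
≡ᵇ-≢ {m} {n} m≢n = ¬T⇒≡false (m≢n ∘ ≡ᵇ⇒≡ m n)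

<ᵇ-< : ∀ {m n} → m < n → (m <ᵇ n) ≡ true
<ᵇ-< m<n = T⇒≡true (<⇒<ᵇ m<n)

<ᵇ-≮ : ∀ {m n} → ¬ m < n → (m <ᵇ n) ≡ false
<ᵇ-≮ {m} {n} m≮n = ¬T⇒≡false (m≮n ∘ <ᵇ⇒< m n)

-- Order isomorphism

-- The test orderIso τ σ applies to positions holding a, b in τ and s, t in σ.
agree : ℕ → ℕ → ℕ → ℕ → Bool
agree a b s t = ((a ≡ᵇ b) ==ᵇ (s ≡ᵇ t)) ∧ ((a <ᵇ b) ==ᵇ (s <ᵇ t))

agree⇒≡ : ∀ {a b s t} → agree a b s t ≡ true → s ≡ t → a ≡ b
agree⇒≡ {a} {b} {s} {t} h s≡t =
  ≡ᵇ⇒≡ a b (subst T (sym (==ᵇ⇒≡ (proj₁ (∧-≡true h)))) (≡⇒≡ᵇ s t s≡t))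

agree⇒< : ∀ {a b s t} → agree a b s t ≡ true → s < t → a < b
agree⇒< {a} {b} {s} {t} h s<t =
  <ᵇ⇒< a b (subst T (sym (==ᵇ⇒≡ (proj₂ (∧-≡true h)))) (<⇒<ᵇ s<t))

agree-intro : ∀ {a b s t} → (a ≡ᵇ b) ≡ (s ≡ᵇ t) → (a <ᵇ b) ≡ (s <ᵇ t) → agree a b s t ≡ true
agree-intro {s = s} {t} e l rewrite e | l = cong₂ _∧_ (==ᵇ-refl (s ≡ᵇ t)) (==ᵇ-refl (s <ᵇ t))

agree-of-cmp : ∀ {a b s t} → (s < t → a < b) → (s ≡ t → a ≡ b) → (t < s → b < a) →
               agree a b s t ≡ true
agree-of-cmp {a} {b} {s} {t} f g h with <-cmp s t
... | tri< s<t s≢t _ = agree-intro {a} {b} {s} {t}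
  (trans (≡ᵇ-≢ (<⇒≢ (f s<t))) (sym (≡ᵇ-≢ s≢t)))
  (trans (<ᵇ-< (f s<t)) (sym (<ᵇ-< s<t)))
... | tri≈ s≮t s≡t _ = agree-intro {a} {b} {s} {t}
  (trans (≡ᵇ-≡ (g s≡t)) (sym (≡ᵇ-≡ s≡t)))
  (trans (<ᵇ-≮ (<-irrefl (g s≡t))) (sym (<ᵇ-≮ s≮t)))
... | tri> s≮t s≢t t<s = agree-intro {a} {b} {s} {t}
  (trans (≡ᵇ-≢ (>⇒≢ (h t<s))) (sym (≡ᵇ-≢ s≢t)))
  (trans (<ᵇ-≮ (<-asym (h t<s))) (sym (<ᵇ-≮ s≮t)))

orderIso⇒agree : ∀ {τ σ a s b t} → orderIso τ σ ≡ true →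
                 (a , s) ∈ zip τ σ → (b , t) ∈ zip τ σ → agree a b s t ≡ true
orderIso⇒agree h as∈ bt∈ = allᵇ-∈ (allᵇ-∈ (proj₂ (∧-≡true h)) as∈) bt∈

orderIso-intro : ∀ τ σ → length τ ≡ length σ →
                 (∀ {a s b t} → (a , s) ∈ zip τ σ → (b , t) ∈ zip τ σ → agree a b s t ≡ true) →
                 orderIso τ σ ≡ true
orderIso-intro τ σ l h rewrite l =
  cong₂ _∧_ (≡ᵇ-≡ {length σ} refl)
            (allᵇ-intro (zip τ σ) λ p∈ → allᵇ-intro (zip τ σ) λ q∈ → h p∈ q∈)

∈-zip-map : ∀ (f : ℕ → ℕ) σ {a s} → (a , s) ∈ zip (map f σ) σ → s ∈ σ × a ≡ f s
∈-zip-map f (x ∷ σ) ∈₀        = ∈₀ , refl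
∈-zip-map f (x ∷ σ) (there m) = let s∈σ , a≡fs = ∈-zip-map f σ m in there s∈σ , a≡fs

orderIso-map : ∀ (f : ℕ → ℕ) σ → (∀ {s t} → s ∈ σ → t ∈ σ → s < t → f s < f t) →
               orderIso (map f σ) σ ≡ true
orderIso-map f σ mono = orderIso-intro (map f σ) σ (length-map f σ) agrees
  where
  agrees : ∀ {a s b t} → (a , s) ∈ zip (map f σ) σ → (b , t) ∈ zip (map f σ) σ → agree a b s t ≡ true
  agrees {s = s} {t = t} as∈ bt∈ with ∈-zip-map f σ as∈ | ∈-zip-map f σ bt∈
  ... | s∈σ , refl | t∈σ , refl = agree-of-cmp {f s} {f t} (mono s∈σ t∈σ) (cong f) (mono t∈σ s∈σ)

InRange : ℕ → List ℕ → Set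
InRange k = All (λ x → 1 ≤ x × x ≤ k)

inRange : ∀ k σ → True (all? (λ x → (1 ≤? x) ×-dec (x ≤? k)) σ) → InRange k σ
inRange k σ = toWitness

nth : List ℕ → ℕ → ℕ
nth []       _       = 0
nth (v ∷ _)  zero    = v
nth (_ ∷ vs) (suc i) = nth vs i

nth-∈ : ∀ vs {i} → i < length vs → nth vs i ∈ vs
nth-∈ (v ∷ vs) {zero}  _         = ∈₀
nth-∈ (v ∷ vs) {suc i} (s≤s i<n) = there (nth-∈ vs i<n)

nth-mono : ∀ {vs i j} → AllPairs _<_ vs → i < j → j < length vs → nth vs i < nth vs j
nth-mono {v ∷ vs} {zero}  {suc j} (v< ∷ _)  _         (s≤s j<n) = All.lookup v< (nth-∈ vs j<n)
nth-mono {v ∷ vs} {suc i} {suc j} (_ ∷ vs<) (s≤s i<j) (s≤s j<n) = nth-mono vs< i<j j<n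

-- The letter x of σ is relabelled by the x-th entry of the increasing list vs.
orderIso-relabel : ∀ vs σ → AllPairs _<_ vs → InRange (length vs) σ →
                   orderIso (map (nth vs ∘ pred) σ) σ ≡ true
orderIso-relabel vs σ vs< range = orderIso-map (nth vs ∘ pred) σ mono
  where
  mono : ∀ {s t} → s ∈ σ → t ∈ σ → s < t → nth vs (pred s) < nth vs (pred t)
  mono s∈σ t∈σ s<t with All.lookup range s∈σ | All.lookup range t∈σ | s<t
  ... | s≤s _ , _ | s≤s _ , t≤n | s≤s ps<pt = nth-mono vs< ps<pt t≤n

orderIso⇒length : ∀ {τ σ} → orderIso τ σ ≡ true → length τ ≡ length σ
orderIso⇒length {τ} {σ} h = ≡ᵇ⇒≡ (length τ) (length σ) (≡true⇒T (proj₁ (∧-≡true h)))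

module OrderIso {τ σ : List ℕ} (h : orderIso τ σ ≡ true) where

  same : ∀ {a s b t} → (a , s) ∈ zip τ σ → (b , t) ∈ zip τ σ → s ≡ t → a ≡ b
  same as∈ bt∈ = agree⇒≡ (orderIso⇒agree h as∈ bt∈)

  less : ∀ {a s b t} → (a , s) ∈ zip τ σ → (b , t) ∈ zip τ σ → s < t → a < b
  less as∈ bt∈ = agree⇒< (orderIso⇒agree h as∈ bt∈)

length≡3 : ∀ {A : Set} (xs : List A) → length xs ≡ 3 → ∃[ a ] ∃[ b ] ∃[ c ] xs ≡ a ∷ b ∷ c ∷ []
length≡3 (a ∷ b ∷ c ∷ []) _ = a , b , c , refl

length≡4 : ∀ {A : Set} (xs : List A) → length xs ≡ 4 →
           ∃[ a ] ∃[ b ] ∃[ c ] ∃[ d ] xs ≡ a ∷ b ∷ c ∷ d ∷ []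
length≡4 (a ∷ b ∷ c ∷ d ∷ []) _ = a , b , c , d , refl

⊆⇒∈subseqs : ∀ {τ π} → τ ⊆ π → τ ∈ subseqs π
⊆⇒∈subseqs []                           = ∈₀
⊆⇒∈subseqs {π = x ∷ π} (.x ∷ʳ τ⊆π) = ∈-++⁺ʳ (map (x ∷_) (subseqs π)) (⊆⇒∈subseqs τ⊆π)
⊆⇒∈subseqs (refl ∷ τ⊆π)               = ∈-++⁺ˡ (∈-map⁺ (_ ∷_) (⊆⇒∈subseqs τ⊆π))

∈subseqs⇒⊆ : ∀ π {τ} → τ ∈ subseqs π → τ ⊆ π
∈subseqs⇒⊆ []      ∈₀ = []
∈subseqs⇒⊆ (x ∷ π) τ∈ with ∈-++⁻ (map (x ∷_) (subseqs π)) τ∈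
... | inj₂ τ∈′ = x ∷ʳ ∈subseqs⇒⊆ π τ∈′
... | inj₁ xτ∈ with ∈-map⁻ (x ∷_) xτ∈
...   | _ , τ∈′ , refl = refl ∷ ∈subseqs⇒⊆ π τ∈′

contains-intro : ∀ {π σ τ} → τ ⊆ π → orderIso τ σ ≡ true → contains π σ ≡ true
contains-intro τ⊆π h = anyᵇ-intro (⊆⇒∈subseqs τ⊆π) h

contains-elim : ∀ {π σ} → contains π σ ≡ true → ∃[ τ ] τ ⊆ π × orderIso τ σ ≡ true
contains-elim {π} h with anyᵇ-elim (subseqs π) h
... | τ , τ∈ , iso = τ , ∈subseqs⇒⊆ π τ∈ , iso

-- Forbidden patterns

patterns : List (List ℕ)
patterns = (1 ∷ 2 ∷ 1 ∷ 2 ∷ []) ∷ (2 ∷ 1 ∷ 2 ∷ 1 ∷ []) ∷ Λ₄₆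

data Forbidden (π : List ℕ) : Set where
  occ1212 : ∀ {a b}   → a < b →         a ∷ b ∷ a ∷ b ∷ [] ⊆ π → Forbidden π
  occ2121 : ∀ {a b}   → a < b →         b ∷ a ∷ b ∷ a ∷ [] ⊆ π → Forbidden π
  occ132  : ∀ {a b c} → a < c → c < b → a ∷ b ∷ c ∷ [] ⊆ π → Forbidden π
  occ213  : ∀ {a b c} → a < b → b < c → b ∷ a ∷ c ∷ [] ⊆ π → Forbidden π

Forbidden-mono : ∀ {π π′} → π ⊆ π′ → Forbidden π → Forbidden π′
Forbidden-mono π⊆ (occ1212 a<b τ⊆)     = occ1212 a<b (⊆-trans τ⊆ π⊆)
Forbidden-mono π⊆ (occ2121 a<b τ⊆)     = occ2121 a<b (⊆-trans τ⊆ π⊆)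
Forbidden-mono π⊆ (occ132 a<c c<b τ⊆) = occ132 a<c c<b (⊆-trans τ⊆ π⊆)
Forbidden-mono π⊆ (occ213 a<b b<c τ⊆) = occ213 a<b b<c (⊆-trans τ⊆ π⊆)

Forbidden⇒contains : ∀ {π} → Forbidden π → ∃[ σ ] σ ∈ patterns × contains π σ ≡ true
Forbidden⇒contains (occ1212 {a} {b} a<b τ⊆) = _ , ∈₀ , contains-intro τ⊆
  (orderIso-relabel (a ∷ b ∷ []) (1 ∷ 2 ∷ 1 ∷ 2 ∷ []) ((a<b ∷ []) ∷ [] ∷ []) (inRange 2 _ _))
Forbidden⇒contains (occ2121 {a} {b} a<b τ⊆) = _ , ∈₁ , contains-intro τ⊆
  (orderIso-relabel (a ∷ b ∷ []) (2 ∷ 1 ∷ 2 ∷ 1 ∷ []) ((a<b ∷ []) ∷ [] ∷ []) (inRange 2 _ _))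
Forbidden⇒contains (occ132 {a} {b} {c} a<c c<b τ⊆) = _ , ∈₂ , contains-intro τ⊆
  (orderIso-relabel (a ∷ c ∷ b ∷ []) (1 ∷ 3 ∷ 2 ∷ [])
    ((a<c ∷ <-trans a<c c<b ∷ []) ∷ (c<b ∷ []) ∷ [] ∷ []) (inRange 3 _ _))
Forbidden⇒contains (occ213 {a} {b} {c} a<b b<c τ⊆) = _ , ∈₃ , contains-intro τ⊆
  (orderIso-relabel (a ∷ b ∷ c ∷ []) (2 ∷ 1 ∷ 3 ∷ [])
    ((a<b ∷ <-trans a<b b<c ∷ []) ∷ (b<c ∷ []) ∷ [] ∷ []) (inRange 3 _ _))

orderIso⇒Forbidden : ∀ {π σ τ} → σ ∈ patterns → τ ⊆ π → orderIso τ σ ≡ true → Forbidden π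
orderIso⇒Forbidden {τ = τ} ∈₀ τ⊆ h with length≡4 τ (orderIso⇒length {τ} h)
... | a , b , a′ , b′ , refl with same ∈₂ ∈₀ refl | same ∈₃ ∈₁ refl
  where open OrderIso {a ∷ b ∷ a′ ∷ b′ ∷ []} {1 ∷ 2 ∷ 1 ∷ 2 ∷ []} h
...   | refl | refl = occ1212 (less ∈₀ ∈₁ (s<s z<s)) τ⊆
  where open OrderIso {a ∷ b ∷ a ∷ b ∷ []} {1 ∷ 2 ∷ 1 ∷ 2 ∷ []} h
orderIso⇒Forbidden {τ = τ} ∈₁ τ⊆ h with length≡4 τ (orderIso⇒length {τ} h)
... | b , a , b′ , a′ , refl with same ∈₂ ∈₀ refl | same ∈₃ ∈₁ refl
  where open OrderIso {b ∷ a ∷ b′ ∷ a′ ∷ []} {2 ∷ 1 ∷ 2 ∷ 1 ∷ []} h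
...   | refl | refl = occ2121 (less ∈₁ ∈₀ (s<s z<s)) τ⊆
  where open OrderIso {b ∷ a ∷ b ∷ a ∷ []} {2 ∷ 1 ∷ 2 ∷ 1 ∷ []} h
orderIso⇒Forbidden {τ = τ} ∈₂ τ⊆ h with length≡3 τ (orderIso⇒length {τ} h)
... | a , b , c , refl = occ132 (less ∈₀ ∈₂ (s<s z<s)) (less ∈₂ ∈₁ (s<s (s<s z<s))) τ⊆
  where open OrderIso {a ∷ b ∷ c ∷ []} {1 ∷ 3 ∷ 2 ∷ []} h
orderIso⇒Forbidden {τ = τ} ∈₃ τ⊆ h with length≡3 τ (orderIso⇒length {τ} h)
... | b , a , c , refl = occ213 (less ∈₁ ∈₀ (s<s z<s)) (less ∈₀ ∈₂ (s<s (s<s z<s))) τ⊆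
  where open OrderIso {b ∷ a ∷ c ∷ []} {2 ∷ 1 ∷ 3 ∷ []} h

avoidsAll⇒¬Forbidden : ∀ {π} → avoidsAll π patterns ≡ true → ¬ Forbidden π
avoidsAll⇒¬Forbidden {π} h occ with Forbidden⇒contains occ
... | σ , σ∈ , c with allᵇ-∈ {p = avoids π} h σ∈
... | avoids≡true rewrite c = case avoids≡true of λ ()

¬Forbidden⇒avoidsAll : ∀ {π} → ¬ Forbidden π → avoidsAll π patterns ≡ true
¬Forbidden⇒avoidsAll {π} ¬occ = allᵇ-intro patterns avoids-σ
  where
  avoids-σ : ∀ {σ} → σ ∈ patterns → avoids π σ ≡ true
  avoids-σ {σ} σ∈ with contains π σ in c
  ... | false = refl
  ... | true  = let _ , τ⊆ , iso = contains-elim c in ⊥-elim (¬occ (orderIso⇒Forbidden σ∈ τ⊆ iso))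

-- Inserting the largest letter twice

⊆-++-split : ∀ {X : Set} (A : List X) {B τ} → τ ⊆ A ++ B →
             ∃[ τ₁ ] ∃[ τ₂ ] τ ≡ τ₁ ++ τ₂ × τ₁ ⊆ A × τ₂ ⊆ B
⊆-++-split []      τ⊆ = [] , _ , refl , [] , τ⊆
⊆-++-split (x ∷ A) (_ ∷ʳ τ⊆) with ⊆-++-split A τ⊆
... | τ₁ , τ₂ , refl , τ₁⊆ , τ₂⊆ = τ₁ , τ₂ , refl , x ∷ʳ τ₁⊆ , τ₂⊆
⊆-++-split (x ∷ A) (refl ∷ τ⊆) with ⊆-++-split A τ⊆
... | τ₁ , τ₂ , refl , τ₁⊆ , τ₂⊆ = x ∷ τ₁ , τ₂ , refl , refl ∷ τ₁⊆ , τ₂⊆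

data InsertionView (n : ℕ) (P Q R τ : List ℕ) : Set where
  neither : ∀ {τ₁ τ₂ τ₃} → τ ≡ τ₁ ++ τ₂ ++ τ₃ →
            τ₁ ⊆ P → τ₂ ⊆ Q → τ₃ ⊆ R → InsertionView n P Q R τ
  first   : ∀ {τ₁ τ₂ τ₃} → τ ≡ τ₁ ++ n ∷ (τ₂ ++ τ₃) →
            τ₁ ⊆ P → τ₂ ⊆ Q → τ₃ ⊆ R → InsertionView n P Q R τ
  second  : ∀ {τ₁ τ₂ τ₃} → τ ≡ (τ₁ ++ τ₂) ++ n ∷ τ₃ →
            τ₁ ⊆ P → τ₂ ⊆ Q → τ₃ ⊆ R → InsertionView n P Q R τ
  both    : ∀ {τ₁ τ₂ τ₃} → τ ≡ τ₁ ++ n ∷ (τ₂ ++ n ∷ τ₃) →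
            τ₁ ⊆ P → τ₂ ⊆ Q → τ₃ ⊆ R → InsertionView n P Q R τ

insertionView : ∀ {n τ} P Q R → τ ⊆ P ++ n ∷ (Q ++ n ∷ R) → InsertionView n P Q R τ
insertionView P Q R τ⊆ with ⊆-++-split P τ⊆
... | τ₁ , _ , refl , τ₁⊆ , (_ ∷ʳ ρ⊆) with ⊆-++-split Q ρ⊆
...   | τ₂ , _ , refl , τ₂⊆ , (_ ∷ʳ τ₃⊆)   = neither refl τ₁⊆ τ₂⊆ τ₃⊆
...   | τ₂ , _ , refl , τ₂⊆ , (refl ∷ τ₃⊆) = second (sym (++-assoc τ₁ τ₂ _)) τ₁⊆ τ₂⊆ τ₃⊆
insertionView P Q R τ⊆ | τ₁ , _ , refl , τ₁⊆ , (refl ∷ ρ⊆) with ⊆-++-split Q ρ⊆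
...   | τ₂ , _ , refl , τ₂⊆ , (_ ∷ʳ τ₃⊆)   = first refl τ₁⊆ τ₂⊆ τ₃⊆
...   | τ₂ , _ , refl , τ₂⊆ , (refl ∷ τ₃⊆) = both refl τ₁⊆ τ₂⊆ τ₃⊆

deletion⊆insertion : ∀ (n : ℕ) (P Q R : List ℕ) → P ++ Q ++ R ⊆ P ++ n ∷ (Q ++ n ∷ R)
deletion⊆insertion n P Q R = ++⁺ (⊆-refl {x = P}) (n ∷ʳ ++⁺ (⊆-refl {x = Q}) (n ∷ʳ ⊆-refl))

Below : ℕ → List ℕ → Set
Below n = All (_< n)

Below⇒∉ : ∀ {n xs} → Below n xs → ¬ n ∈ xs
Below⇒∉ xs<n n∈xs = <-irrefl refl (All.lookup xs<n n∈xs)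

¬Below-++-∷ : ∀ {n} xs {ys} → ¬ Below n (xs ++ n ∷ ys)
¬Below-++-∷ xs below = Below⇒∉ below (∈-++⁺ʳ xs ∈₀)

++-∷-cancel : ∀ {n} xs ys {xs′ ys′} → Below n xs → Below n ys →
              xs ++ n ∷ xs′ ≡ ys ++ n ∷ ys′ → xs ≡ ys × xs′ ≡ ys′
++-∷-cancel []       []       _           _           refl = refl , refl
++-∷-cancel []       (y ∷ ys) _           (n<n ∷ _)   refl = ⊥-elim (<-irrefl refl n<n)
++-∷-cancel (x ∷ xs) []       (n<n ∷ _)   _           refl = ⊥-elim (<-irrefl refl n<n)
++-∷-cancel (x ∷ xs) (y ∷ ys) (_ ∷ xs<n) (_ ∷ ys<n) eq with ∷-injective eq
... | refl , eq′ with ++-∷-cancel xs ys xs<n ys<n eq′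
...   | refl , refl = refl , refl

Below-deletion : ∀ {n τ τ₁ τ₂ τ₃} P Q R → Below n P → Below n Q → Below n R →
                 τ ≡ τ₁ ++ τ₂ ++ τ₃ → τ₁ ⊆ P → τ₂ ⊆ Q → τ₃ ⊆ R → Below n τ
Below-deletion P Q R P<n Q<n R<n refl τ₁⊆ τ₂⊆ τ₃⊆ =
  All-++⁺ (All-resp-⊆ τ₁⊆ P<n) (All-++⁺ (All-resp-⊆ τ₂⊆ Q<n) (All-resp-⊆ τ₃⊆ R<n))

⊆-insertion⇒⊆-deletion : ∀ {n τ} P Q R → Below n τ →
                         τ ⊆ P ++ n ∷ (Q ++ n ∷ R) → τ ⊆ P ++ Q ++ R
⊆-insertion⇒⊆-deletion P Q R τ<n τ⊆ with insertionView P Q R τ⊆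
... | neither refl τ₁⊆ τ₂⊆ τ₃⊆      = ++⁺ τ₁⊆ (++⁺ τ₂⊆ τ₃⊆)
... | first {τ₁} refl _ _ _         = ⊥-elim (¬Below-++-∷ τ₁ τ<n)
... | second {τ₁} {τ₂} refl _ _ _   = ⊥-elim (¬Below-++-∷ (τ₁ ++ τ₂) τ<n)
... | both {τ₁} refl _ _ _          = ⊥-elim (¬Below-++-∷ τ₁ τ<n)

⊆-insertion-once : ∀ {n} P Q R pre post → Below n P → Below n Q → Below n R → Below n pre → Below n post →
                   pre ++ n ∷ post ⊆ P ++ n ∷ (Q ++ n ∷ R) →
                   (pre ⊆ P × post ⊆ Q ++ R) ⊎ (pre ⊆ P ++ Q × post ⊆ R)
⊆-insertion-once P Q R pre post P<n Q<n R<n pre<n post<n τ⊆ with insertionView P Q R τ⊆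
... | neither eq τ₁⊆ τ₂⊆ τ₃⊆ = ⊥-elim (¬Below-++-∷ pre (Below-deletion P Q R P<n Q<n R<n eq τ₁⊆ τ₂⊆ τ₃⊆))
... | first {τ₁} eq τ₁⊆ τ₂⊆ τ₃⊆ with ++-∷-cancel pre τ₁ pre<n (All-resp-⊆ τ₁⊆ P<n) eq
...   | refl , refl = inj₁ (τ₁⊆ , ++⁺ τ₂⊆ τ₃⊆)
⊆-insertion-once P Q R pre post P<n Q<n R<n pre<n post<n τ⊆ | second {τ₁} {τ₂} eq τ₁⊆ τ₂⊆ τ₃⊆
  with ++-∷-cancel pre (τ₁ ++ τ₂) pre<n (All-++⁺ (All-resp-⊆ τ₁⊆ P<n) (All-resp-⊆ τ₂⊆ Q<n)) eq
...   | refl , refl = inj₂ (++⁺ τ₁⊆ τ₂⊆ , τ₃⊆)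
⊆-insertion-once P Q R pre post P<n Q<n R<n pre<n post<n τ⊆ | both {τ₁} {τ₂} eq τ₁⊆ τ₂⊆ τ₃⊆
  with ++-∷-cancel pre τ₁ pre<n (All-resp-⊆ τ₁⊆ P<n) eq
...   | refl , refl = ⊥-elim (¬Below-++-∷ τ₂ post<n)

⊆-insertion-twice : ∀ {n} P Q R pre mid post → Below n P → Below n Q → Below n R →
                    Below n pre → Below n mid →
                    pre ++ n ∷ (mid ++ n ∷ post) ⊆ P ++ n ∷ (Q ++ n ∷ R) →
                    pre ⊆ P × mid ⊆ Q × post ⊆ R
⊆-insertion-twice P Q R pre mid post P<n Q<n R<n pre<n mid<n τ⊆ with insertionView P Q R τ⊆
... | neither eq τ₁⊆ τ₂⊆ τ₃⊆ = ⊥-elim (¬Below-++-∷ pre (Below-deletion P Q R P<n Q<n R<n eq τ₁⊆ τ₂⊆ τ₃⊆))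
... | first {τ₁} eq τ₁⊆ τ₂⊆ τ₃⊆ with ++-∷-cancel pre τ₁ pre<n (All-resp-⊆ τ₁⊆ P<n) eq
...   | refl , eq′ =
  ⊥-elim (¬Below-++-∷ mid (subst (Below _) (sym eq′) (All-++⁺ (All-resp-⊆ τ₂⊆ Q<n) (All-resp-⊆ τ₃⊆ R<n))))
⊆-insertion-twice P Q R pre mid post P<n Q<n R<n pre<n mid<n τ⊆ | second {τ₁} {τ₂} eq τ₁⊆ τ₂⊆ τ₃⊆
  with ++-∷-cancel pre (τ₁ ++ τ₂) pre<n (All-++⁺ (All-resp-⊆ τ₁⊆ P<n) (All-resp-⊆ τ₂⊆ Q<n)) eq
...   | refl , eq′ = ⊥-elim (¬Below-++-∷ mid (subst (Below _) (sym eq′) (All-resp-⊆ τ₃⊆ R<n)))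
⊆-insertion-twice P Q R pre mid post P<n Q<n R<n pre<n mid<n τ⊆ | both {τ₁} {τ₂} eq τ₁⊆ τ₂⊆ τ₃⊆
  with ++-∷-cancel pre τ₁ pre<n (All-resp-⊆ τ₁⊆ P<n) eq
...   | refl , eq′ with ++-∷-cancel mid τ₂ mid<n (All-resp-⊆ τ₂⊆ Q<n) eq′
...     | refl , refl = τ₁⊆ , τ₂⊆ , τ₃⊆

data ForbiddenInsertion (P Q R : List ℕ) : Set where
  inherited : Forbidden (P ++ Q ++ R) → ForbiddenInsertion P Q R
  top132₁   : ∀ {a c} → a < c → a ∈ P → c ∈ Q ++ R → ForbiddenInsertion P Q R
  top132₂   : ∀ {a c} → a < c → a ∈ P ++ Q → c ∈ R → ForbiddenInsertion P Q R
  top213₁   : ∀ {a b} → a < b → b ∷ a ∷ [] ⊆ P → ForbiddenInsertion P Q R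
  top213₂   : ∀ {a b} → a < b → b ∷ a ∷ [] ⊆ P ++ Q → ForbiddenInsertion P Q R
  top1212   : ∀ {a} → a ∈ P → a ∈ Q → ForbiddenInsertion P Q R
  top2121   : ∀ {a} → a ∈ Q → a ∈ R → ForbiddenInsertion P Q R

-- An occurrence either avoids the letter n, and survives deleting it, or uses n as its largest letter.
forbiddenInsertion : ∀ n P Q R → Below n P → Below n Q → Below n R →
                     Forbidden (P ++ n ∷ (Q ++ n ∷ R)) → ForbiddenInsertion P Q R
forbiddenInsertion n P Q R P<n Q<n R<n = classify
  where
  π = P ++ n ∷ (Q ++ n ∷ R)

  π≤n : All (_≤ n) π
  π≤n = All-++⁺ (All.map <⇒≤ P<n) (≤-refl ∷ All-++⁺ (All.map <⇒≤ Q<n) (≤-refl ∷ All.map <⇒≤ R<n))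

  below : ∀ {x τ} → τ ⊆ π → x ∈ τ → x ≢ n → x < n
  below τ⊆ x∈τ = ≤∧≢⇒< (All.lookup π≤n (lookup τ⊆ x∈τ))

  deleted : ∀ {τ} → Below n τ → τ ⊆ π → τ ⊆ P ++ Q ++ R
  deleted = ⊆-insertion⇒⊆-deletion P Q R

  classify : Forbidden π → ForbiddenInsertion P Q R
  classify (occ132 {a} {b} {c} a<c c<b τ⊆) with b ≟ n
  ... | yes refl with ⊆-insertion-once P Q R (a ∷ []) (c ∷ []) P<n Q<n R<n (<-trans a<c c<b ∷ []) (c<b ∷ []) τ⊆
  ...   | inj₁ (a⊆ , c⊆) = top132₁ a<c (to∈ a⊆) (to∈ c⊆)
  ...   | inj₂ (a⊆ , c⊆) = top132₂ a<c (to∈ a⊆) (to∈ c⊆)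
  classify (occ132 a<c c<b τ⊆) | no b≢n =
    let b<n = below τ⊆ ∈₁ b≢n in
    inherited (occ132 a<c c<b (deleted (<-trans a<c (<-trans c<b b<n) ∷ b<n ∷ <-trans c<b b<n ∷ []) τ⊆))
  classify (occ213 {a} {b} {c} a<b b<c τ⊆) with c ≟ n
  ... | yes refl with ⊆-insertion-once P Q R (b ∷ a ∷ []) [] P<n Q<n R<n (b<c ∷ <-trans a<b b<c ∷ []) [] τ⊆
  ...   | inj₁ (ba⊆ , _) = top213₁ a<b ba⊆
  ...   | inj₂ (ba⊆ , _) = top213₂ a<b ba⊆
  classify (occ213 a<b b<c τ⊆) | no c≢n =
    let c<n = below τ⊆ ∈₂ c≢n in
    inherited (occ213 a<b b<c (deleted (<-trans b<c c<n ∷ <-trans a<b (<-trans b<c c<n) ∷ c<n ∷ []) τ⊆))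
  classify (occ1212 {a} {b} a<b τ⊆) with b ≟ n
  ... | yes refl with ⊆-insertion-twice P Q R (a ∷ []) (a ∷ []) [] P<n Q<n R<n (a<b ∷ []) (a<b ∷ []) τ⊆
  ...   | a⊆P , a⊆Q , _ = top1212 (to∈ a⊆P) (to∈ a⊆Q)
  classify (occ1212 a<b τ⊆) | no b≢n =
    let b<n = below τ⊆ ∈₁ b≢n in
    inherited (occ1212 a<b (deleted (<-trans a<b b<n ∷ b<n ∷ <-trans a<b b<n ∷ b<n ∷ []) τ⊆))
  classify (occ2121 {a} {b} a<b τ⊆) with b ≟ n
  ... | yes refl with ⊆-insertion-twice P Q R [] (a ∷ []) (a ∷ []) P<n Q<n R<n [] (a<b ∷ []) τ⊆
  ...   | _ , a⊆Q , a⊆R = top2121 (to∈ a⊆Q) (to∈ a⊆R)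
  classify (occ2121 a<b τ⊆) | no b≢n =
    let b<n = below τ⊆ ∈₀ b≢n in
    inherited (occ2121 a<b (deleted (b<n ∷ <-trans a<b b<n ∷ b<n ∷ <-trans a<b b<n ∷ []) τ⊆))

NonDecreasing : List ℕ → Set
NonDecreasing L = ∀ {x y} → x ∷ y ∷ [] ⊆ L → x ≤ y

Dominates : List ℕ → List ℕ → Set
Dominates L R = ∀ {x y} → x ∈ L → y ∈ R → y ≤ x

StrictlyDominates : List ℕ → List ℕ → Set
StrictlyDominates L R = ∀ {x y} → x ∈ L → y ∈ R → y < x

avoids-adjacent-insertion : ∀ {n} L R → Below n L → Below n R → NonDecreasing L → Dominates L R →
                           ¬ Forbidden (L ++ R) → ¬ Forbidden (L ++ n ∷ n ∷ R)
avoids-adjacent-insertion {n} L R L<n R<n L↑ L≥R avoid occ with forbiddenInsertion n L [] R L<n [] R<n occ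
... | inherited occ′        = avoid occ′
... | top132₁ a<c a∈L c∈R   = ≤⇒≯ (L≥R a∈L c∈R) a<c
... | top132₂ a<c a∈L c∈R   = ≤⇒≯ (L≥R (subst (_ ∈_) (++-identityʳ L) a∈L) c∈R) a<c
... | top213₁ a<b ba⊆L      = ≤⇒≯ (L↑ ba⊆L) a<b
... | top213₂ a<b ba⊆L      = ≤⇒≯ (L↑ (subst (_ ⊆_) (++-identityʳ L) ba⊆L)) a<b
... | top2121 () _

avoids-enclosing-insertion : ∀ {n} X R → Below n X → Below n R → NonDecreasing X → StrictlyDominates X R →
                            ¬ Forbidden (X ++ R) → ¬ Forbidden (n ∷ X ++ n ∷ R)
avoids-enclosing-insertion {n} X R X<n R<n X↑ X>R avoid occ with forbiddenInsertion n [] X R [] X<n R<n occ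
... | inherited occ′      = avoid occ′
... | top132₂ a<c a∈X c∈R = <-asym a<c (X>R a∈X c∈R)
... | top213₂ a<b ba⊆X    = ≤⇒≯ (X↑ ba⊆X) a<b
... | top2121 a∈X a∈R     = <-irrefl refl (X>R a∈X a∈R)

⊆-insertion-around : ∀ {n : ℕ} {τ ρ} P Q R → τ ⊆ P ++ Q → ρ ⊆ R →
                     τ ++ n ∷ ρ ⊆ P ++ n ∷ (Q ++ n ∷ R)
⊆-insertion-around {n} {ρ = ρ} P Q R τ⊆ ρ⊆ with ⊆-++-split P τ⊆
... | τ₁ , τ₂ , refl , τ₁⊆ , τ₂⊆ rewrite ++-assoc τ₁ τ₂ (n ∷ ρ) =
  ++⁺ τ₁⊆ (n ∷ʳ ++⁺ τ₂⊆ (refl ∷ ρ⊆))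

module AvoidingInsertion {n} (P Q R : List ℕ) (P<n : Below n P) (Q<n : Below n Q) (R<n : Below n R)
                         (avoid : ¬ Forbidden (P ++ n ∷ (Q ++ n ∷ R))) where

  deletion-avoids : ¬ Forbidden (P ++ Q ++ R)
  deletion-avoids = avoid ∘ Forbidden-mono (deletion⊆insertion n P Q R)

  prefix-or-middle-empty : ∀ {x y} → x ∈ P → y ∈ Q → ⊥
  prefix-or-middle-empty {x} {y} x∈P y∈Q with <-cmp x y
  ... | tri< x<y _ _  = avoid (occ132 x<y (All.lookup Q<n y∈Q) (++⁺ x⊆P (refl ∷ ++⁺ y⊆Q (minimum _))))
    where x⊆P = from∈ x∈P ; y⊆Q = from∈ y∈Q
  ... | tri≈ _ refl _ = avoid (occ1212 (All.lookup P<n x∈P) (++⁺ x⊆P (refl ∷ ++⁺ y⊆Q (refl ∷ minimum _))))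
    where x⊆P = from∈ x∈P ; y⊆Q = from∈ y∈Q
  ... | tri> _ _ y<x  = avoid (occ213 y<x (All.lookup P<n x∈P)
                          (⊆-insertion-around P Q R (++⁺ (from∈ x∈P) (from∈ y∈Q)) (minimum _)))

  nonDecreasing : NonDecreasing (P ++ Q)
  nonDecreasing {x} {y} xy⊆ with <-cmp x y
  ... | tri< x<y _ _  = <⇒≤ x<y
  ... | tri≈ _ refl _ = ≤-refl
  ... | tri> _ _ y<x  = ⊥-elim (avoid (occ213 y<x (All.lookup (All-++⁺ P<n Q<n) (to∈ xy⊆))
                                   (⊆-insertion-around P Q R xy⊆ (minimum _))))

  dominates : Dominates (P ++ Q) R
  dominates {x} {y} x∈ y∈R with <-cmp x y
  ... | tri< x<y _ _  = ⊥-elim (avoid (occ132 x<y (All.lookup R<n y∈R)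
                                   (⊆-insertion-around P Q R (from∈ x∈) (from∈ y∈R))))
  ... | tri≈ _ refl _ = ≤-refl
  ... | tri> _ _ y<x  = <⇒≤ y<x

  strictlyDominates : StrictlyDominates Q R
  strictlyDominates {x} {y} x∈Q y∈R with <-cmp x y
  ... | tri< x<y _ _  = ⊥-elim (avoid (occ132 x<y (All.lookup R<n y∈R)
                                   (⊆-insertion-around P Q R (++⁺ˡ P (from∈ x∈Q)) (from∈ y∈R))))
  ... | tri≈ _ refl _ = ⊥-elim (avoid (occ2121 (All.lookup Q<n x∈Q)
                                   (++⁺ˡ P (refl ∷ ++⁺ (from∈ x∈Q) (refl ∷ from∈ y∈R)))))
  ... | tri> _ _ y<x  = y<x

-- Permutations of the multiset {1, 1, …, m, m}

count-∷ : ∀ v x xs → count v (x ∷ xs) ≡ count v [ x ] + count v xs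
count-∷ v x xs with v ≡ᵇ x
... | true  = refl
... | false = refl

count-++ : ∀ v xs ys → count v (xs ++ ys) ≡ count v xs + count v ys
count-++ v []       ys = refl
count-++ v (x ∷ xs) ys with v ≡ᵇ x
... | true  = cong suc (count-++ v xs ys)
... | false = count-++ v xs ys

count-insertion : ∀ v n P Q R → count v (P ++ n ∷ (Q ++ n ∷ R)) ≡ count v (n ∷ n ∷ []) + count v (P ++ Q ++ R)
count-insertion v n P Q R
  rewrite count-++ v P (n ∷ (Q ++ n ∷ R)) | count-∷ v n (Q ++ n ∷ R) | count-++ v Q (n ∷ R) | count-∷ v n R
        | count-∷ v n [ n ] | count-++ v P (Q ++ R) | count-++ v Q R
  = shuffle (count v P) (count v [ n ]) (count v Q) (count v R)
  where
  shuffle : ∀ p c q r → p + (c + (q + (c + r))) ≡ c + c + (p + (q + r))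
  shuffle = solve-∀

count-self : ∀ n xs → count n (n ∷ xs) ≡ suc (count n xs)
count-self n xs rewrite ≡ᵇ-≡ {n} refl = refl

count-other : ∀ {v x} xs → v ≢ x → count v (x ∷ xs) ≡ count v xs
count-other xs v≢x rewrite ≡ᵇ-≢ v≢x = refl

count-absent : ∀ n xs → All (_≢ n) xs → count n xs ≡ 0
count-absent n []       []             = refl
count-absent n (x ∷ xs) (x≢n ∷ xs≢n) rewrite count-other xs (x≢n ∘ sym) = count-absent n xs xs≢n

count≡0⇒absent : ∀ n xs → count n xs ≡ 0 → All (_≢ n) xs
count≡0⇒absent n []       _ = []
count≡0⇒absent n (x ∷ xs) c with n ≟ x
... | yes refl rewrite count-self n xs = case c of λ ()
... | no n≢x rewrite count-other xs n≢x = (n≢x ∘ sym) ∷ count≡0⇒absent n xs c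

count-first : ∀ n xs {k} → count n xs ≡ suc k →
              ∃[ P ] ∃[ ys ] xs ≡ P ++ n ∷ ys × All (_≢ n) P × count n ys ≡ k
count-first n (x ∷ xs) c with n ≟ x
... | yes refl rewrite count-self n xs = [] , xs , refl , [] , suc-injective c
... | no n≢x rewrite count-other xs n≢x with count-first n xs c
...   | P , ys , refl , P≢n , c′ = x ∷ P , ys , refl , (n≢x ∘ sym) ∷ P≢n , c′

length-insertion : ∀ (n : ℕ) P Q R → length (P ++ n ∷ (Q ++ n ∷ R)) ≡ 2 + length (P ++ Q ++ R)
length-insertion n []      Q R = cong suc (length-++-sucʳ Q n R)
length-insertion n (_ ∷ P) Q R = cong suc (length-insertion n P Q R)

All-insertion : ∀ {p : ℕ → Set} {n} P Q R → All p (P ++ Q ++ R) → p n → All p (P ++ n ∷ (Q ++ n ∷ R))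
All-insertion P Q R all pn =
  All-++⁺ (All-++⁻ˡ P all) (pn ∷ All-++⁺ (All-++⁻ˡ Q (All-++⁻ʳ P all)) (pn ∷ All-++⁻ʳ Q (All-++⁻ʳ P all)))

All-deletion : ∀ {p : ℕ → Set} {n} P Q R → All p (P ++ n ∷ (Q ++ n ∷ R)) → All p (P ++ Q ++ R)
All-deletion P Q R all with All-++⁻ʳ P all
... | _ ∷ all′ with All-++⁻ʳ Q all′
...   | _ ∷ allR = All-++⁺ (All-++⁻ˡ P all) (All-++⁺ (All-++⁻ˡ Q all′) allR)

record IsSnn (m : ℕ) (w : List ℕ) : Set where
  field
    positive : All (0 <_) w
    bounded  : Below (suc m) w
    twice    : ∀ v → 0 < v → v < suc m → count v w ≡ 2
    length≡  : length w ≡ 2 * m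

count-pair-self : ∀ n → count n (n ∷ n ∷ []) ≡ 2
count-pair-self n rewrite ≡ᵇ-≡ {n} refl = refl

count-pair-other : ∀ {v n} → v ≢ n → count v (n ∷ n ∷ []) ≡ 0
count-pair-other v≢n rewrite ≡ᵇ-≢ v≢n = refl

IsSnn-insertion : ∀ {m} P Q R → IsSnn m (P ++ Q ++ R) → IsSnn (suc m) (P ++ suc m ∷ (Q ++ suc m ∷ R))
IsSnn-insertion {m} P Q R snn = record
  { positive = All-insertion P Q R positive z<s
  ; bounded  = All-insertion P Q R (All.map m<n⇒m<1+n bounded) (n<1+n (suc m))
  ; twice    = twice′
  ; length≡  = trans (length-insertion (suc m) P Q R) (trans (cong (λ l → 2 + l) length≡) (sym (*-suc 2 m)))
  }
  where
  open IsSnn snn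
  twice′ : ∀ v → 0 < v → v < suc (suc m) → count v (P ++ suc m ∷ (Q ++ suc m ∷ R)) ≡ 2
  twice′ v 0<v v<n+1 rewrite count-insertion v (suc m) P Q R with v ≟ suc m
  ... | yes refl rewrite count-pair-self (suc m)
                       | count-absent (suc m) (P ++ Q ++ R) (All.map <⇒≢ bounded) = refl
  ... | no v≢n rewrite count-pair-other v≢n = twice v 0<v (≤∧≢⇒< (s≤s⁻¹ v<n+1) v≢n)

IsSnn-deletion : ∀ {m} P Q R → Below (suc m) P → Below (suc m) Q → Below (suc m) R →
                 IsSnn (suc m) (P ++ suc m ∷ (Q ++ suc m ∷ R)) → IsSnn m (P ++ Q ++ R)
IsSnn-deletion {m} P Q R P<n Q<n R<n snn = record
  { positive = All-deletion P Q R positive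
  ; bounded  = All-++⁺ P<n (All-++⁺ Q<n R<n)
  ; twice    = twice′
  ; length≡  = suc-injective (suc-injective
                 (trans (sym (length-insertion (suc m) P Q R)) (trans length≡ (*-suc 2 m))))
  }
  where
  open IsSnn snn
  twice′ : ∀ v → 0 < v → v < suc m → count v (P ++ Q ++ R) ≡ 2
  twice′ v 0<v v<n = begin
    count v (P ++ Q ++ R)
      ≡⟨ cong (_+ count v (P ++ Q ++ R)) (sym (count-pair-other (<⇒≢ v<n))) ⟩
    count v (suc m ∷ suc m ∷ []) + count v (P ++ Q ++ R)
      ≡⟨ sym (count-insertion v (suc m) P Q R) ⟩
    count v (P ++ suc m ∷ (Q ++ suc m ∷ R))
      ≡⟨ twice v 0<v (m<n⇒m<1+n v<n) ⟩
    2 ∎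

-- The generating tree

data Tag : Set where
  pair strict tied : Tag

data Node : Set where
  node : Tag → List ℕ → List ℕ → Node

word : Node → List ℕ
word (node _ F S) = F ++ S

-- For a pair node F = m m with m = pred n, so the third child is m n n m S.
children : ℕ → Node → List Node
children n (node pair F S) =
  node pair (n ∷ n ∷ []) (F ++ S) ∷ node strict (F ++ n ∷ n ∷ []) S ∷
  node tied (pred n ∷ n ∷ n ∷ []) (pred n ∷ S) ∷ node tied (n ∷ []) (F ++ n ∷ S) ∷ []
children n (node strict F S) =
  node pair (n ∷ n ∷ []) (F ++ S) ∷ node strict (F ++ n ∷ n ∷ []) S ∷ node tied (n ∷ []) (F ++ n ∷ S) ∷ []
children n (node tied F S) =
  node pair (n ∷ n ∷ []) (F ++ S) ∷ node tied (F ++ n ∷ n ∷ []) S ∷ []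

-- level k holds the words of Q̄ₖ₊₁(Λ).
level : ℕ → List Node
level zero    = node pair (1 ∷ 1 ∷ []) [] ∷ []
level (suc k) = concatMap (children (2 + k)) (level k)

RunEnds : List ℕ → List ℕ → Set
RunEnds F []      = ⊤
RunEnds F (y ∷ _) = ∃[ x ] x ∈ F × y < x

-- Rules out inserting n n strictly inside the run F (possible only for pair nodes).
Varied : List ℕ → Set
Varied F = (∃[ x ] F ≡ x ∷ []) ⊎ (∃[ x ] ∃[ y ] x ∈ F × y ∈ F × x < y)

-- By ends, F is the longest weakly increasing prefix of the word F ++ S.
record IsRunSplit (m : ℕ) (F S : List ℕ) : Set where
  field
    snn       : IsSnn m (F ++ S)
    avoiding  : ¬ Forbidden (F ++ S)
    run↑      : NonDecreasing F
    nonempty  : ∃[ f ] ∃[ F′ ] F ≡ f ∷ F′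
    ends      : RunEnds F S
    dominates : Dominates F S

TagInvariant : ℕ → Tag → List ℕ → List ℕ → Set
TagInvariant m pair   F S = F ≡ m ∷ m ∷ [] × Below m S
TagInvariant m strict F S = StrictlyDominates F S × Varied F
TagInvariant m tied   F S = Varied F × ∃[ x ] ∃[ y ] x ∈ F × y ∈ S × x ≤ y

Valid : ℕ → Node → Set
Valid m (node t F S) = IsRunSplit m F S × TagInvariant m t F S

nonDecreasing-[] : NonDecreasing []
nonDecreasing-[] ()

nonDecreasing-∷ : ∀ {x L} → NonDecreasing L → All (x ≤_) L → NonDecreasing (x ∷ L)
nonDecreasing-∷ L↑ x≤L (_ ∷ʳ xy⊆)   = L↑ xy⊆
nonDecreasing-∷ L↑ x≤L (refl ∷ y⊆) = All.lookup x≤L (to∈ y⊆)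

nonDecreasing-[x] : ∀ {x} → NonDecreasing [ x ]
nonDecreasing-[x] = nonDecreasing-∷ nonDecreasing-[] []

nonDecreasing-++ : ∀ {F G} → NonDecreasing F → NonDecreasing G →
                   (∀ {x y} → x ∈ F → y ∈ G → x ≤ y) → NonDecreasing (F ++ G)
nonDecreasing-++ {F} F↑ G↑ F≤G xy⊆ with ⊆-++-split F xy⊆
... | []        , _       , refl , _   , xy⊆G = G↑ xy⊆G
... | _ ∷ []    , _ ∷ []  , refl , x⊆F , y⊆G = F≤G (to∈ x⊆F) (to∈ y⊆G)
... | _ ∷ _ ∷ [] , []     , refl , xy⊆F , _  = F↑ xy⊆F

dominates-threshold : ∀ {k L w} → All (k ≤_) L → All (_≤ k) w → Dominates L w
dominates-threshold k≤L w≤k x∈L y∈w = ≤-trans (All.lookup w≤k y∈w) (All.lookup k≤L x∈L)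

strictlyDominates-threshold : ∀ {k L w} → All (k ≤_) L → Below k w → StrictlyDominates L w
strictlyDominates-threshold k≤L w<k x∈L y∈w = <-≤-trans (All.lookup w<k y∈w) (All.lookup k≤L x∈L)

¬Forbidden-[] : ¬ Forbidden []
¬Forbidden-[] (occ1212 _ ())
¬Forbidden-[] (occ2121 _ ())
¬Forbidden-[] (occ132 _ _ ())
¬Forbidden-[] (occ213 _ _ ())

module ChildrenOf {m} (F S : List ℕ) (split : IsRunSplit m F S) where
  open IsRunSplit split

  private
    n = suc m
    FS<n = IsSnn.bounded snn
    F<n = All-++⁻ˡ F FS<n
    S<n = All-++⁻ʳ F FS<n

  valid-front : Valid n (node pair (n ∷ n ∷ []) (F ++ S))
  valid-front = record
    { snn       = IsSnn-insertion [] [] (F ++ S) snn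
    ; avoiding  = avoids-adjacent-insertion [] (F ++ S) [] FS<n nonDecreasing-[] (λ ()) avoiding
    ; run↑      = nonDecreasing-∷ nonDecreasing-[x] (≤-refl ∷ [])
    ; nonempty  = n , n ∷ [] , refl
    ; ends      = ends-front nonempty
    ; dominates = dominates-threshold (≤-refl ∷ ≤-refl ∷ []) (All.map <⇒≤ FS<n)
    } , refl , FS<n
    where
    ends-front : ∃[ f ] ∃[ F′ ] F ≡ f ∷ F′ → RunEnds (n ∷ n ∷ []) (F ++ S)
    ends-front (_ , _ , refl) = n , ∈₀ , All.lookup F<n ∈₀

  runSplit-append : IsRunSplit n (F ++ n ∷ n ∷ []) S
  runSplit-append = record
    { snn       = subst (IsSnn n) (sym (++-assoc F _ S)) (IsSnn-insertion F [] S snn)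
    ; avoiding  = subst (¬_ ∘ Forbidden) (sym (++-assoc F _ S))
                    (avoids-adjacent-insertion F S F<n S<n run↑ dominates avoiding)
    ; run↑      = nonDecreasing-++ run↑ (nonDecreasing-∷ nonDecreasing-[x] (≤-refl ∷ []))
                    (λ x∈F y∈nn → <⇒≤ (strictlyDominates-threshold (≤-refl ∷ ≤-refl ∷ []) F<n y∈nn x∈F))
    ; nonempty  = nonempty-append nonempty
    ; ends      = ends-append S ends
    ; dominates = dominates-append
    }
    where
    nonempty-append : ∃[ f ] ∃[ F′ ] F ≡ f ∷ F′ → ∃[ f ] ∃[ F′ ] F ++ n ∷ n ∷ [] ≡ f ∷ F′
    nonempty-append (f , F′ , refl) = f , F′ ++ n ∷ n ∷ [] , refl
    ends-append : ∀ S → RunEnds F S → RunEnds (F ++ n ∷ n ∷ []) S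
    ends-append []      _                = tt
    ends-append (_ ∷ _) (x , x∈F , y<x) = x , ∈-++⁺ˡ x∈F , y<x
    dominates-append : Dominates (F ++ n ∷ n ∷ []) S
    dominates-append x∈ y∈S with ∈-++⁻ F x∈
    ... | inj₁ x∈F = dominates x∈F y∈S
    ... | inj₂ x∈nn = dominates-threshold (≤-refl ∷ ≤-refl ∷ []) (All.map <⇒≤ S<n) x∈nn y∈S

  varied-append : Varied (F ++ n ∷ n ∷ [])
  varied-append with nonempty
  ... | f , F′ , refl = inj₂ (f , n , ∈₀ , ∈-++⁺ʳ (f ∷ F′) ∈₀ , All.lookup F<n ∈₀)

  valid-append-strict : StrictlyDominates F S → Valid n (node strict (F ++ n ∷ n ∷ []) S)
  valid-append-strict F>S = runSplit-append , strictlyDominates-append , varied-append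
    where
    strictlyDominates-append : StrictlyDominates (F ++ n ∷ n ∷ []) S
    strictlyDominates-append x∈ y∈S with ∈-++⁻ F x∈
    ... | inj₁ x∈F  = F>S x∈F y∈S
    ... | inj₂ x∈nn = strictlyDominates-threshold (≤-refl ∷ ≤-refl ∷ []) S<n x∈nn y∈S

  valid-append-tied : (∃[ x ] ∃[ y ] x ∈ F × y ∈ S × x ≤ y) → Valid n (node tied (F ++ n ∷ n ∷ []) S)
  valid-append-tied (x , y , x∈F , y∈S , x≤y) = runSplit-append , varied-append , (x , y , ∈-++⁺ˡ x∈F , y∈S , x≤y)

  valid-enclose : StrictlyDominates F S → Valid n (node tied [ n ] (F ++ n ∷ S))
  valid-enclose F>S = record
    { snn       = snn′
    ; avoiding  = avoids-enclosing-insertion F S F<n S<n run↑ F>S avoiding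
    ; run↑      = nonDecreasing-[x]
    ; nonempty  = n , [] , refl
    ; ends      = ends-enclose nonempty
    ; dominates = dominates-threshold (≤-refl ∷ []) (All.map s≤s⁻¹ (All-++⁻ʳ [ n ] (IsSnn.bounded snn′)))
    } , inj₁ (n , refl) , (n , n , ∈₀ , ∈-++⁺ʳ F ∈₀ , ≤-refl)
    where
    snn′ = IsSnn-insertion [] F S snn
    ends-enclose : ∃[ f ] ∃[ F′ ] F ≡ f ∷ F′ → RunEnds [ n ] (F ++ n ∷ S)
    ends-enclose (_ , _ , refl) = n , ∈₀ , All.lookup F<n ∈₀

valid-pair-inside : ∀ {m} S → IsRunSplit m (m ∷ m ∷ []) S → Below m S →
                    Valid (suc m) (node tied (m ∷ suc m ∷ suc m ∷ []) (m ∷ S))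
valid-pair-inside {m} S split S<m = record
  { snn       = IsSnn-insertion [ m ] [] (m ∷ S) snn
  ; avoiding  = avoids-adjacent-insertion [ m ] (m ∷ S) (n<1+n m ∷ []) (n<1+n m ∷ All.map m<n⇒m<1+n S<m)
                  nonDecreasing-[x] (dominates-threshold (≤-refl ∷ []) mS≤m) avoiding
  ; run↑      = nonDecreasing-∷ (nonDecreasing-∷ nonDecreasing-[x] (≤-refl ∷ [])) (m≤n ∷ m≤n ∷ [])
  ; nonempty  = m , _ , refl
  ; ends      = suc m , ∈₁ , n<1+n m
  ; dominates = dominates-threshold (≤-refl ∷ m≤n ∷ m≤n ∷ []) mS≤m
  } , inj₂ (m , suc m , ∈₀ , ∈₁ , n<1+n m) , (m , m , ∈₀ , ∈₀ , ≤-refl)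
  where
  open IsRunSplit split
  m≤n = <⇒≤ (n<1+n m)
  mS≤m : All (_≤ m) (m ∷ S)
  mS≤m = ≤-refl ∷ All.map <⇒≤ S<m

valid-child : ∀ {m} x {c} → Valid m x → c ∈ children (suc m) x → Valid (suc m) c
valid-child (node pair _ S) (split , refl , _) ∈₀ = ChildrenOf.valid-front _ S split
valid-child (node pair _ S) (split , refl , S<m) ∈₁ =
  ChildrenOf.valid-append-strict _ S split (strictlyDominates-threshold (≤-refl ∷ ≤-refl ∷ []) S<m)
valid-child (node pair _ S) (split , refl , S<m) ∈₂ = valid-pair-inside S split S<m
valid-child (node pair _ S) (split , refl , S<m) ∈₃ =
  ChildrenOf.valid-enclose _ S split (strictlyDominates-threshold (≤-refl ∷ ≤-refl ∷ []) S<m)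
valid-child (node strict F S) (split , _ , _) ∈₀ = ChildrenOf.valid-front F S split
valid-child (node strict F S) (split , F>S , _) ∈₁ = ChildrenOf.valid-append-strict F S split F>S
valid-child (node strict F S) (split , F>S , _) ∈₂ = ChildrenOf.valid-enclose F S split F>S
valid-child (node tied F S)   (split , _ , _) ∈₀ = ChildrenOf.valid-front F S split
valid-child (node tied F S)   (split , _ , tie) ∈₁ = ChildrenOf.valid-append-tied F S split tie

valid-root : Valid 1 (node pair (1 ∷ 1 ∷ []) [])
valid-root = record
  { snn       = IsSnn-insertion [] [] [] empty
  ; avoiding  = avoids-adjacent-insertion [] [] [] [] nonDecreasing-[] (λ ()) ¬Forbidden-[]
  ; run↑      = nonDecreasing-∷ nonDecreasing-[x] (≤-refl ∷ [])
  ; nonempty  = 1 , [ 1 ] , refl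
  ; ends      = tt
  ; dominates = λ _ ()
  } , refl , []
  where
  empty : IsSnn 0 []
  empty = record { positive = [] ; bounded = [] ; twice = λ { .(suc _) z<s (s≤s ()) } ; length≡ = refl }

valid-level : ∀ k {x} → x ∈ level k → Valid (suc k) x
valid-level zero    ∈₀ = valid-root
valid-level (suc k) x∈ with find (∈-concatMap⁻ (children (2 + k)) {xs = level k} x∈)
... | p , p∈ , x∈children = valid-child p (valid-level k p∈) x∈children

-- Every avoiding word arises in the tree

Produces : ℕ → Node → List ℕ → Set
Produces n x π = ∃[ c ] c ∈ children n x × word c ≡ π

produces-front : ∀ n t F S → Produces n (node t F S) (n ∷ n ∷ (F ++ S))
produces-front n pair   F S = _ , ∈₀ , refl
produces-front n strict F S = _ , ∈₀ , refl
produces-front n tied   F S = _ , ∈₀ , refl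

produces-append : ∀ n t F S → Produces n (node t F S) (F ++ n ∷ n ∷ S)
produces-append n pair   F S = _ , ∈₁ , ++-assoc F (n ∷ n ∷ []) S
produces-append n strict F S = _ , ∈₁ , ++-assoc F (n ∷ n ∷ []) S
produces-append n tied   F S = _ , ∈₁ , ++-assoc F (n ∷ n ∷ []) S

produces-enclose : ∀ {m} t F S → Valid m (node t F S) → StrictlyDominates F S →
                   Produces (suc m) (node t F S) (suc m ∷ (F ++ suc m ∷ S))
produces-enclose pair   F S _ _ = _ , ∈₃ , refl
produces-enclose strict F S _ _ = _ , ∈₂ , refl
produces-enclose tied   F S (_ , _ , x , y , x∈F , y∈S , x≤y) F>S = ⊥-elim (≤⇒≯ x≤y (F>S x∈F y∈S))

++-≡-++ : ∀ {X : Set} (F S P R : List X) → F ++ S ≡ P ++ R →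
          (∃[ E ] P ≡ F ++ E × S ≡ E ++ R) ⊎ (∃[ E ] F ≡ P ++ E × R ≡ E ++ S)
++-≡-++ []      S P       R eq = inj₁ (P , refl , eq)
++-≡-++ (f ∷ F) S []      R eq = inj₂ (f ∷ F , refl , sym eq)
++-≡-++ (f ∷ F) S (p ∷ P) R eq with ∷-injective eq
... | refl , eq′ with ++-≡-++ F S P R eq′
...   | inj₁ (E , refl , S≡) = inj₁ (E , refl , S≡)
...   | inj₂ (E , refl , R≡) = inj₂ (E , refl , R≡)

¬nonDecreasing-past-run : ∀ {m F e S E} → IsRunSplit m F (e ∷ S) → ¬ NonDecreasing (F ++ e ∷ E)
¬nonDecreasing-past-run split F↑ with IsRunSplit.ends split
... | x , x∈F , e<x = ≤⇒≯ (F↑ (++⁺ (from∈ x∈F) (refl ∷ minimum _))) e<x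

¬Varied-constant : ∀ p P e E → (∀ {a b} → a ∈ p ∷ P → b ∈ e ∷ E → a ≡ b) → ¬ Varied ((p ∷ P) ++ e ∷ E)
¬Varied-constant p []      e E _ (inj₁ (_ , ()))
¬Varied-constant p (_ ∷ _) e E _ (inj₁ (_ , ()))
¬Varied-constant p P e E same (inj₂ (x , y , x∈ , y∈ , x<y)) = <-irrefl (trans (≡e x∈) (sym (≡e y∈))) x<y
  where
  ≡e : ∀ {a} → a ∈ (p ∷ P) ++ e ∷ E → a ≡ e
  ≡e a∈ with ∈-++⁻ (p ∷ P) a∈
  ... | inj₁ a∈P = same a∈P ∈₀
  ... | inj₂ a∈E = trans (sym (same ∈₀ a∈E)) (same ∈₀ ∈₀)

run-constant : ∀ {m p P e E S} → IsRunSplit m ((p ∷ P) ++ e ∷ E) S → Dominates (p ∷ P) ((e ∷ E) ++ S) →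
               ∀ {a b} → a ∈ p ∷ P → b ∈ e ∷ E → a ≡ b
run-constant split P≥ES a∈ b∈ =
  ≤-antisym (IsRunSplit.run↑ split (++⁺ (from∈ a∈) (from∈ b∈))) (P≥ES a∈ (∈-++⁺ˡ b∈))

produces-adjacent-in-run : ∀ {m} t P E S → Valid m (node t (P ++ E) S) → Dominates P (E ++ S) →
                           Produces (suc m) (node t (P ++ E) S) (P ++ suc m ∷ suc m ∷ (E ++ S))
produces-adjacent-in-run t [] E S _ _ = produces-front _ t E S
produces-adjacent-in-run {m} t P@(_ ∷ _) [] S _ _ rewrite ++-identityʳ P = produces-append (suc m) t P S
produces-adjacent-in-run pair (_ ∷ []) (_ ∷ []) S (_ , refl , _) _ = _ , ∈₂ , refl
produces-adjacent-in-run pair (_ ∷ []) (_ ∷ _ ∷ _) S (_ , () , _) _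
produces-adjacent-in-run pair (_ ∷ _ ∷ []) (_ ∷ _) S (_ , () , _) _
produces-adjacent-in-run pair (_ ∷ _ ∷ _ ∷ _) (_ ∷ _) S (_ , () , _) _
produces-adjacent-in-run strict (p ∷ P) (e ∷ E) S (split , _ , varied) P≥ES =
  ⊥-elim (¬Varied-constant p P e E (run-constant split P≥ES) varied)
produces-adjacent-in-run tied (p ∷ P) (e ∷ E) S (split , varied , _) P≥ES =
  ⊥-elim (¬Varied-constant p P e E (run-constant split P≥ES) varied)

produces-adjacent : ∀ {m} x P R → Valid m x → word x ≡ P ++ R → NonDecreasing P → Dominates P R →
                    Produces (suc m) x (P ++ suc m ∷ suc m ∷ R)
produces-adjacent {m} (node t F S) P R valid w≡ P↑ P≥R with ++-≡-++ F S P R w≡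
... | inj₁ ([] , refl , refl) rewrite ++-identityʳ F = produces-append (suc m) t F S
... | inj₁ (_ ∷ _ , refl , refl) = ⊥-elim (¬nonDecreasing-past-run (proj₁ valid) P↑)
... | inj₂ (E , refl , refl) = produces-adjacent-in-run t P E S valid P≥R

produces-enclosing : ∀ {m q} x Q R → q ∈ Q → Valid m x → word x ≡ Q ++ R →
                     NonDecreasing Q → StrictlyDominates Q R → Produces (suc m) x (suc m ∷ (Q ++ suc m ∷ R))
produces-enclosing (node t F S) Q R q∈Q valid w≡ Q↑ Q>R with ++-≡-++ F S Q R w≡
... | inj₁ ([] , refl , refl) with F ++ [] | ++-identityʳ F
...   | _ | refl = produces-enclose t F S valid Q>R
produces-enclosing (node t F S) Q R q∈Q valid w≡ Q↑ Q>R | inj₁ (_ ∷ _ , refl , refl) =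
  ⊥-elim (¬nonDecreasing-past-run (proj₁ valid) Q↑)
produces-enclosing (node t F S) Q R q∈Q valid w≡ Q↑ Q>R | inj₂ ([] , refl , refl) with Q ++ [] | ++-identityʳ Q
...   | _ | refl = produces-enclose t Q S valid Q>R
produces-enclosing (node t F S) Q R q∈Q valid w≡ Q↑ Q>R | inj₂ (_ ∷ _ , refl , refl) =
  ⊥-elim (≤⇒≯ (IsRunSplit.run↑ (proj₁ valid) (++⁺ (from∈ q∈Q) (refl ∷ minimum _))) (Q>R q∈Q ∈₀))

produces-insertion : ∀ {m} x P Q R → Valid m x → word x ≡ P ++ Q ++ R →
                     Below (suc m) P → Below (suc m) Q → Below (suc m) R →
                     ¬ Forbidden (P ++ suc m ∷ (Q ++ suc m ∷ R)) →
                     Produces (suc m) x (P ++ suc m ∷ (Q ++ suc m ∷ R))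
produces-insertion x P [] R valid w≡ P<n Q<n R<n avoid =
  produces-adjacent x P R valid w≡ (nonDecreasing ∘ ++⁺ʳ []) (dominates ∘ ∈-++⁺ˡ)
  where open AvoidingInsertion P [] R P<n Q<n R<n avoid
produces-insertion x [] Q@(_ ∷ _) R valid w≡ P<n Q<n R<n avoid =
  produces-enclosing x Q R ∈₀ valid w≡ nonDecreasing strictlyDominates
  where open AvoidingInsertion [] Q R P<n Q<n R<n avoid
produces-insertion x (_ ∷ _) (_ ∷ _) R valid w≡ P<n Q<n R<n avoid =
  ⊥-elim (AvoidingInsertion.prefix-or-middle-empty _ _ R P<n Q<n R<n avoid ∈₀ ∈₀)

split-at-top-letter : ∀ {k π} → IsSnn (suc k) π →
                  ∃[ P ] ∃[ Q ] ∃[ R ] π ≡ P ++ suc k ∷ (Q ++ suc k ∷ R) ×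
                                       Below (suc k) P × Below (suc k) Q × Below (suc k) R
split-at-top-letter {k} {π} snn with count-first (suc k) π (twice (suc k) z<s (n<1+n (suc k)))
  where open IsSnn snn
... | P , π′ , refl , P≢n , c₁ with count-first (suc k) π′ c₁
...   | Q , R , refl , Q≢n , c₀ =
  P , Q , R , refl , below P≤n P≢n , below Q≤n Q≢n , below R≤n (count≡0⇒absent (suc k) R c₀)
  where
  open IsSnn snn
  below : ∀ {xs} → Below (suc (suc k)) xs → All (_≢ suc k) xs → Below (suc k) xs
  below xs≤n xs≢n = All.zipWith (λ (x≤n , x≢n) → ≤∧≢⇒< (s≤s⁻¹ x≤n) x≢n) (xs≤n , xs≢n)
  P≤n = All-++⁻ˡ P bounded
  QnR≤n = All.tail (All-++⁻ʳ P bounded)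
  Q≤n = All-++⁻ˡ Q QnR≤n
  R≤n = All.tail (All-++⁻ʳ Q QnR≤n)

positive-below-1 : ∀ {xs} → All (0 <_) xs → Below 1 xs → xs ≡ []
positive-below-1 []            []        = refl
positive-below-1 (0<x ∷ _) (s≤s x≤0 ∷ _) = ⊥-elim (<-irrefl refl (<-≤-trans 0<x x≤0))

level-complete : ∀ k {π} → IsSnn (suc k) π → ¬ Forbidden π → ∃[ x ] x ∈ level k × word x ≡ π
level-complete zero snn avoid with split-at-top-letter snn
... | P , Q , R , refl , P<1 , Q<1 , R<1
  with positive-below-1 (All-++⁻ˡ P pos) P<1 | positive-below-1 (All-++⁻ˡ Q (All-++⁻ʳ P pos)) Q<1
     | positive-below-1 (All-++⁻ʳ Q (All-++⁻ʳ P pos)) R<1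
  where pos = IsSnn.positive (IsSnn-deletion P Q R P<1 Q<1 R<1 snn)
...   | refl | refl | refl = _ , ∈₀ , refl
level-complete (suc k) snn avoid with split-at-top-letter snn
... | P , Q , R , refl , P<n , Q<n , R<n
  with level-complete k (IsSnn-deletion P Q R P<n Q<n R<n snn)
                        (AvoidingInsertion.deletion-avoids P Q R P<n Q<n R<n avoid)
...   | x , x∈ , w≡ with produces-insertion x P Q R (valid-level k x∈) w≡ P<n Q<n R<n avoid
...     | c , c∈ , wc = c , ∈-concatMap⁺ (children (2 + k)) {xs = level k} (lose x∈ c∈) , wc

-- The tree produces each word once

erase : ℕ → List ℕ → List ℕ
erase n = filter (λ x → ¬? (x ≟ n))

erase-below : ∀ {n xs} → Below n xs → erase n xs ≡ xs
erase-below {n} xs<n = filter-all (λ x → ¬? (x ≟ n)) (All.map <⇒≢ xs<n)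

erase-insertion : ∀ n P Q R → Below n P → Below n Q → Below n R → erase n (P ++ n ∷ (Q ++ n ∷ R)) ≡ P ++ Q ++ R
erase-insertion n P Q R P<n Q<n R<n = begin
  erase n (P ++ n ∷ (Q ++ n ∷ R))         ≡⟨ filter-++ ≢n? P _ ⟩
  erase n P ++ erase n (n ∷ (Q ++ n ∷ R)) ≡⟨ cong₂ _++_ (erase-below P<n) (erase-top (Q ++ n ∷ R)) ⟩
  P ++ erase n (Q ++ n ∷ R)               ≡⟨ cong (P ++_) (filter-++ ≢n? Q _) ⟩
  P ++ erase n Q ++ erase n (n ∷ R)       ≡⟨ cong (P ++_) (cong₂ _++_ (erase-below Q<n) erase-R) ⟩
  P ++ Q ++ R                             ∎
  where
  ≢n? = λ x → ¬? (x ≟ n)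
  erase-top : ∀ xs → erase n (n ∷ xs) ≡ erase n xs
  erase-top xs = filter-reject ≢n? (λ n≢n → n≢n refl)
  erase-R : erase n (n ∷ R) ≡ R
  erase-R = trans (erase-top R) (erase-below R<n)

erase-child : ∀ {m} x {c} → Valid m x → c ∈ children (suc m) x → erase (suc m) (word c) ≡ word x
erase-child {m} (node t F S) {c} (split , tagInv) = erase-by-tag t tagInv
  where
  n = suc m
  FS<n = IsSnn.bounded (IsRunSplit.snn split)
  F<n = All-++⁻ˡ F FS<n
  S<n = All-++⁻ʳ F FS<n
  front : erase n (n ∷ n ∷ (F ++ S)) ≡ F ++ S
  front = erase-insertion n [] [] (F ++ S) [] [] FS<n
  append : erase n ((F ++ n ∷ n ∷ []) ++ S) ≡ F ++ S
  append rewrite ++-assoc F (n ∷ n ∷ []) S = erase-insertion n F [] S F<n [] S<n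
  enclose : erase n (n ∷ (F ++ n ∷ S)) ≡ F ++ S
  enclose = erase-insertion n [] F S [] F<n S<n
  erase-by-tag : ∀ t → TagInvariant m t F S → c ∈ children n (node t F S) → erase n (word c) ≡ F ++ S
  erase-by-tag pair   _           ∈₀ = front
  erase-by-tag pair   _           ∈₁ = append
  erase-by-tag pair   (refl , _)  ∈₂ = erase-insertion n [ m ] [] (m ∷ S) (n<1+n m ∷ []) [] (n<1+n m ∷ S<n)
  erase-by-tag pair   _           ∈₃ = enclose
  erase-by-tag strict _           ∈₀ = front
  erase-by-tag strict _           ∈₁ = append
  erase-by-tag strict _           ∈₂ = enclose
  erase-by-tag tied   _           ∈₀ = front
  erase-by-tag tied   _           ∈₁ = append

head-≢ : ∀ {a b : ℕ} {xs ys} → a ≢ b → a ∷ xs ≢ b ∷ ys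
head-≢ a≢b eq = a≢b (proj₁ (∷-injective eq))

second-≢ : ∀ {a b c d : ℕ} {xs ys} → a ≢ b → c ∷ a ∷ xs ≢ d ∷ b ∷ ys
second-≢ a≢b eq = head-≢ a≢b (proj₂ (∷-injective eq))

children-distinct : ∀ {m} x → Valid m x → Unique (map word (children (suc m) x))
children-distinct {m} (node pair _ S) (_ , refl , _) =
  (head-≢ n≢m ∷ head-≢ n≢m ∷ second-≢ n≢m ∷ []) ∷ (second-≢ m≢n ∷ head-≢ m≢n ∷ []) ∷ (head-≢ m≢n ∷ []) ∷ [] ∷ []
  where m≢n = <⇒≢ (n<1+n m)
        n≢m = >⇒≢ (n<1+n m)
children-distinct (node strict F S) (split , _) with IsRunSplit.nonempty split | IsSnn.bounded (IsRunSplit.snn split)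
... | f , F′ , refl | f<n ∷ _ = (head-≢ (>⇒≢ f<n) ∷ second-≢ (>⇒≢ f<n) ∷ []) ∷ (head-≢ (<⇒≢ f<n) ∷ []) ∷ [] ∷ []
children-distinct (node tied F S) (split , _) with IsRunSplit.nonempty split | IsSnn.bounded (IsRunSplit.snn split)
... | f , F′ , refl | f<n ∷ _ = (head-≢ (>⇒≢ f<n) ∷ []) ∷ [] ∷ []

Unique-map-concatMap : ∀ {A B C : Set} (g : A → B) (h : C → B) (ch : A → List C) xs →
                       (∀ {x} → x ∈ xs → Unique (map h (ch x))) →
                       (∀ {x x′ c c′} → x ∈ xs → x′ ∈ xs → c ∈ ch x → c′ ∈ ch x′ → h c ≡ h c′ → g x ≡ g x′) →
                       Unique (map g xs) → Unique (map h (concatMap ch xs))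
Unique-map-concatMap g h ch []       _    _        _              = []
Unique-map-concatMap g h ch (x ∷ xs) uniq recover (gx∉ ∷ uniqXs) rewrite map-++ h (ch x) (concatMap ch xs) =
  Unique.++⁺ (uniq ∈₀) rest disjoint
  where
  rest = Unique-map-concatMap g h ch xs (uniq ∘ there) (λ x∈ x′∈ → recover (there x∈) (there x′∈)) uniqXs
  disjoint : ∀ {v} → ¬ (v ∈ map h (ch x) × v ∈ map h (concatMap ch xs))
  disjoint (v∈ , v∈′) with ∈-map⁻ h v∈ | ∈-map⁻ h v∈′
  ... | c , c∈ , refl | c′ , c′∈ , hc≡hc′ with find (∈-concatMap⁻ ch {xs = xs} c′∈)
  ...   | x′ , x′∈ , c′∈ch = All.lookup gx∉ (∈-map⁺ g x′∈) (recover ∈₀ (there x′∈) c∈ c′∈ch hc≡hc′)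

level-distinct : ∀ k → Unique (map word (level k))
level-distinct zero    = [] ∷ []
level-distinct (suc k) =
  Unique-map-concatMap word word (children (2 + k)) (level k)
    (λ x∈ → children-distinct _ (valid-level k x∈))
    (λ {x} {x′} {c} {c′} x∈ x′∈ c∈ c′∈ wc≡wc′ → begin
      word x                  ≡⟨ sym (erase-child x (valid-level k x∈) c∈) ⟩
      erase (2 + k) (word c)  ≡⟨ cong (erase (2 + k)) wc≡wc′ ⟩
      erase (2 + k) (word c′) ≡⟨ erase-child x′ (valid-level k x′∈) c′∈ ⟩
      word x′                 ∎)
    (level-distinct k)

-- Counting by enumeration

valid-word : ∀ {m} x → Valid m x → IsSnn m (word x) × ¬ Forbidden (word x)
valid-word (node _ _ _) (split , _) = IsRunSplit.snn split , IsRunSplit.avoiding split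

length-unique : ∀ {A : Set} {xs ys : List A} → Unique xs → Unique ys → (∀ {z} → z ∈ xs ⇔ z ∈ ys) →
                length xs ≡ length ys
length-unique xs-unique ys-unique same = ↭-length (∼bag⇒↭ (unique∧set⇒bag xs-unique ys-unique same))

∈alphabet⇒ : ∀ {n x} → x ∈ alphabet n → 0 < x × x < suc n
∈alphabet⇒ x∈ with ∈-map⁻ suc x∈
... | _ , y∈ , refl = z<s , s<s (∈-upTo⁻ y∈)

⇒∈alphabet : ∀ {n x} → 0 < x → x < suc n → x ∈ alphabet n
⇒∈alphabet {x = suc _} _ (s<s x<n) = ∈-map⁺ suc (∈-upTo⁺ x<n)

extend : ℕ → List ℕ → List (List ℕ)
extend n w = map (_∷ w) (alphabet n)

allWords-complete : ∀ n π → All (_∈ alphabet n) π → π ∈ allWords n (length π)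
allWords-complete n []      []          = ∈₀
allWords-complete n (a ∷ w) (a∈ ∷ w∈) =
  ∈-concatMap⁺ (extend n) {xs = allWords n (length w)} (lose (allWords-complete n w w∈) (∈-map⁺ (_∷ w) a∈))

allWords-sound : ∀ n m {π} → π ∈ allWords n m → length π ≡ m × All (_∈ alphabet n) π
allWords-sound n zero    ∈₀ = refl , []
allWords-sound n (suc m) π∈ with find (∈-concatMap⁻ (extend n) {xs = allWords n m} π∈)
... | w , w∈ , π∈extend with ∈-map⁻ (_∷ w) π∈extend
...   | a , a∈ , refl = let len , w⊆ = allWords-sound n m w∈ in cong suc len , a∈ ∷ w⊆

allWords-distinct : ∀ n m → Unique (allWords n m)
allWords-distinct n zero    = [] ∷ []
allWords-distinct n (suc m) =
  subst Unique (map-id _)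
    (Unique-map-concatMap id id (extend n) (allWords n m) extend-distinct same-tail
      (subst Unique (sym (map-id _)) (allWords-distinct n m)))
  where
  extend-distinct : ∀ {w} → w ∈ allWords n m → Unique (map id (extend n w))
  extend-distinct _ = subst Unique (sym (map-id _))
    (Unique.map⁺ (proj₁ ∘ ∷-injective) (Unique.map⁺ suc-injective (Unique.upTo⁺ n)))
  same-tail : ∀ {w w′ c c′} → w ∈ allWords n m → w′ ∈ allWords n m →
              c ∈ extend n w → c′ ∈ extend n w′ → c ≡ c′ → w ≡ w′
  same-tail {w} {w′} _ _ c∈ c′∈ c≡c′ with ∈-map⁻ (_∷ w) c∈ | ∈-map⁻ (_∷ w′) c′∈
  ... | _ , _ , refl | _ , _ , refl = proj₂ (∷-injective c≡c′)

inQbar⇒ : ∀ n {π} → π ∈ allWords n (2 * n) → inQbar n Λ₄₆ π ≡ true → IsSnn n π × ¬ Forbidden π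
inQbar⇒ n {π} π∈ h = snn , avoidsAll⇒¬Forbidden (proj₂ inQbar-parts)
  where
  inQbar-parts = ∧-≡true {inSnn n π} h
  inSnn-parts = ∧-≡true {length π ≡ᵇ 2 * n} (proj₁ inQbar-parts)
  letters = proj₂ (allWords-sound n (2 * n) π∈)
  snn : IsSnn n π
  snn = record
    { positive = All.map (proj₁ ∘ ∈alphabet⇒) letters
    ; bounded  = All.map (proj₂ ∘ ∈alphabet⇒) letters
    ; twice    = λ v 0<v v<n → ≡ᵇ⇒≡ (count v π) 2 (≡true⇒T
                   (allᵇ-∈ (proj₂ inSnn-parts) (⇒∈alphabet 0<v v<n)))
    ; length≡  = proj₁ (allWords-sound n (2 * n) π∈)
    }

⇒inQbar : ∀ n {π} → IsSnn n π → ¬ Forbidden π → π ∈ allWords n (2 * n) × inQbar n Λ₄₆ π ≡ true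
⇒inQbar n {π} snn avoid =
  subst (λ m → π ∈ allWords n m) length≡ (allWords-complete n π letters) ,
  cong₂ _∧_ (cong₂ _∧_ (≡ᵇ-≡ length≡) (allᵇ-intro (alphabet n) twice′)) (¬Forbidden⇒avoidsAll avoid)
  where
  open IsSnn snn
  letters : All (_∈ alphabet n) π
  letters = All.zipWith (λ (0<x , x<n) → ⇒∈alphabet 0<x x<n) (positive , bounded)
  twice′ : ∀ {v} → v ∈ alphabet n → (count v π ≡ᵇ 2) ≡ true
  twice′ v∈ = let 0<v , v<n = ∈alphabet⇒ v∈ in ≡ᵇ-≡ (twice _ 0<v v<n)

qbar-level : ∀ k → qbar Λ₄₆ (suc k) ≡ length (level k)
qbar-level k = trans
  (length-unique (Unique.filter⁺ inQbar? (allWords-distinct n (2 * n))) (level-distinct k) (mk⇔ to from))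
  (length-map word (level k))
  where
  n = suc k
  inQbar? = λ π → inQbar n Λ₄₆ π Bool.≟ true
  to : ∀ {π} → π ∈ filter inQbar? (allWords n (2 * n)) → π ∈ map word (level k)
  to π∈ with ∈-filter⁻ inQbar? {xs = allWords n (2 * n)} π∈
  ... | π∈all , h with inQbar⇒ n π∈all h
  ...   | snn , avoid with level-complete k snn avoid
  ...     | x , x∈ , refl = ∈-map⁺ word x∈
  from : ∀ {π} → π ∈ map word (level k) → π ∈ filter inQbar? (allWords n (2 * n))
  from π∈ with ∈-map⁻ word π∈
  ... | x , x∈ , refl with valid-word x (valid-level k x∈)
  ...   | snn , avoid with ⇒inQbar n snn avoid
  ...     | π∈all , h = ∈-filter⁺ inQbar? π∈all h

-- Counting the tree by tags

δ : Tag → Tag → ℕ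
δ pair   pair   = 1
δ strict strict = 1
δ tied   tied   = 1
δ _      _      = 0

count-tag : Tag → List Node → ℕ
count-tag t []                 = 0
count-tag t (node t′ _ _ ∷ xs) = δ t t′ + count-tag t xs

Tally : Set
Tally = ℕ × ℕ × ℕ

tally : List Node → Tally
tally xs = count-tag pair xs , count-tag strict xs , count-tag tied xs

total : Tally → ℕ
total (a , b , c) = a + b + c

_⊕_ : Tally → Tally → Tally
(a , b , c) ⊕ (a′ , b′ , c′) = a + a′ , b + b′ , c + c′

-- A pair node has children pair, strict, tied, tied; a strict one pair, strict, tied; a tied one pair, tied.
step : Tally → Tally
step (a , b , c) = a + b + c , a + b , a + (a + b + c)

count-tag-++ : ∀ t xs ys → count-tag t (xs ++ ys) ≡ count-tag t xs + count-tag t ys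
count-tag-++ t []                 ys = refl
count-tag-++ t (node t′ _ _ ∷ xs) ys rewrite count-tag-++ t xs ys = sym (+-assoc (δ t t′) _ _)

tally-++ : ∀ xs ys → tally (xs ++ ys) ≡ tally xs ⊕ tally ys
tally-++ xs ys =
  cong₂ _,_ (count-tag-++ pair xs ys) (cong₂ _,_ (count-tag-++ strict xs ys) (count-tag-++ tied xs ys))

step-⊕ : ∀ u v → step (u ⊕ v) ≡ step u ⊕ step v
step-⊕ (a , b , c) (a′ , b′ , c′) =
  cong₂ _,_ (regroup₁ a b c a′ b′ c′) (cong₂ _,_ (regroup₂ a b a′ b′) (regroup₃ a b c a′ b′ c′))
  where
  regroup₁ : ∀ a b c a′ b′ c′ → a + a′ + (b + b′) + (c + c′) ≡ a + b + c + (a′ + b′ + c′)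
  regroup₁ = solve-∀
  regroup₂ : ∀ a b a′ b′ → a + a′ + (b + b′) ≡ a + b + (a′ + b′)
  regroup₂ = solve-∀
  regroup₃ : ∀ a b c a′ b′ c′ →
             a + a′ + (a + a′ + (b + b′) + (c + c′)) ≡ a + (a + b + c) + (a′ + (a′ + b′ + c′))
  regroup₃ = solve-∀

tally-children : ∀ n x → tally (children n x) ≡ step (tally [ x ])
tally-children n (node pair   _ _) = refl
tally-children n (node strict _ _) = refl
tally-children n (node tied   _ _) = refl

tally-concatMap-children : ∀ n xs → tally (concatMap (children n) xs) ≡ step (tally xs)
tally-concatMap-children n []       = refl
tally-concatMap-children n (x ∷ xs) = begin
  tally (children n x ++ concatMap (children n) xs)
    ≡⟨ tally-++ (children n x) _ ⟩
  tally (children n x) ⊕ tally (concatMap (children n) xs)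
    ≡⟨ cong₂ _⊕_ (tally-children n x) (tally-concatMap-children n xs) ⟩
  step (tally [ x ]) ⊕ step (tally xs)
    ≡⟨ sym (step-⊕ (tally [ x ]) (tally xs)) ⟩
  step (tally [ x ] ⊕ tally xs)
    ≡⟨ cong step (sym (tally-++ [ x ] xs)) ⟩
  step (tally (x ∷ xs)) ∎

length≡total-tally : ∀ xs → length xs ≡ total (tally xs)
length≡total-tally []                      = refl
length≡total-tally (node pair   _ _ ∷ xs) = cong suc (length≡total-tally xs)
length≡total-tally (node strict _ _ ∷ xs) rewrite length≡total-tally xs =
  +-suc-middle (count-tag pair xs) (count-tag strict xs) (count-tag tied xs)
  where
  +-suc-middle : ∀ a b c → suc (a + b + c) ≡ a + suc b + c
  +-suc-middle = solve-∀
length≡total-tally (node tied   _ _ ∷ xs) rewrite length≡total-tally xs =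
  +-suc-last (count-tag pair xs) (count-tag strict xs) (count-tag tied xs)
  where
  +-suc-last : ∀ a b c → suc (a + b + c) ≡ a + b + suc c
  +-suc-last = solve-∀

-- In terms of x = T k, p = T (k + 1) and the strict count q at level k + 2.
total-step-recurrence : ∀ s → total s + total (step (step (step s))) ≡ 3 * total (step (step s))
total-step-recurrence (a , b , c) = identity (a + b + c) (a + b + c + (a + b) + (a + (a + b + c))) (a + b + c + (a + b))
  where
  identity : ∀ x p q → x + (p + q + (x + p) + (p + q) + (p + (p + q + (x + p)))) ≡ 3 * (p + q + (x + p))
  identity = solve-∀

tally-level : ∀ k → tally (level (suc k)) ≡ step (tally (level k))
tally-level k = tally-concatMap-children (2 + k) (level k)

level-recurrence : ∀ k → length (level k) + length (level (3 + k)) ≡ 3 * length (level (2 + k))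
level-recurrence k = begin
  length (level k) + length (level (3 + k))
    ≡⟨ cong₂ _+_ (length≡total-tally (level k)) (length≡total-tally (level (3 + k))) ⟩
  total s + total (tally (level (3 + k)))
    ≡⟨ cong (λ t → total s + total t) (trans (tally-level (2 + k)) (cong step tally₂)) ⟩
  total s + total (step (step (step s)))
    ≡⟨ total-step-recurrence s ⟩
  3 * total (step (step s))
    ≡⟨ cong (λ t → 3 * total t) (sym tally₂) ⟩
  3 * total (tally (level (2 + k)))
    ≡⟨ cong (3 *_) (sym (length≡total-tally (level (2 + k)))) ⟩
  3 * length (level (2 + k)) ∎
  where
  s = tally (level k)
  tally₂ : tally (level (2 + k)) ≡ step (step s)
  tally₂ = trans (tally-level (suc k)) (cong step (tally-level k))

qbar-recurrence : ∀ m → qbar Λ₄₆ (1 + m) + qbar Λ₄₆ (4 + m) ≡ 3 * qbar Λ₄₆ (3 + m)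
qbar-recurrence m rewrite qbar-level m | qbar-level (3 + m) | qbar-level (2 + m) = level-recurrence m

-- The series identity

sumℤ-++ : ∀ xs ys → sumℤ (xs ++ ys) ≡ sumℤ xs +ℤ sumℤ ys
sumℤ-++ []       ys = sym (ℤ.+-identityˡ (sumℤ ys))
sumℤ-++ (x ∷ xs) ys rewrite sumℤ-++ xs ys = sym (ℤ.+-assoc x (sumℤ xs) (sumℤ ys))

sumℤ-upTo-suc : ∀ (g : ℕ → ℤ) j → sumℤ (map g (upTo (suc j))) ≡ sumℤ (map g (upTo j)) +ℤ g j
sumℤ-upTo-suc g j = begin
  sumℤ (map g (upTo (suc j)))              ≡⟨ cong (sumℤ ∘ map g) (sym (upTo-∷ʳ j)) ⟩
  sumℤ (map g (upTo j ++ [ j ]))           ≡⟨ cong sumℤ (map-++ g (upTo j) [ j ]) ⟩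
  sumℤ (map g (upTo j) ++ [ g j ])         ≡⟨ sumℤ-++ (map g (upTo j)) [ g j ] ⟩
  sumℤ (map g (upTo j)) +ℤ (g j +ℤ + 0)    ≡⟨ cong (sumℤ (map g (upTo j)) +ℤ_) (ℤ.+-identityʳ (g j)) ⟩
  sumℤ (map g (upTo j)) +ℤ g j             ∎

sumℤ-zero : ∀ (g : ℕ → ℤ) xs → (∀ {k} → k ∈ xs → g k ≡ + 0) → sumℤ (map g xs) ≡ + 0
sumℤ-zero g []       _    = refl
sumℤ-zero g (x ∷ xs) g≡0 rewrite g≡0 ∈₀ | sumℤ-zero g xs (g≡0 ∘ there) = refl

den-vanishes : ∀ i → 4 ≤ i → den i ≡ + 0
den-vanishes (suc (suc (suc (suc _)))) _                   = refl
den-vanishes 1                         (s≤s ())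
den-vanishes 2                         (s≤s (s≤s ()))
den-vanishes 3                         (s≤s (s≤s (s≤s ())))

4≤3+m∸k : ∀ {k m} → k < m → 4 ≤ 3 + m ∸ k
4≤3+m∸k {zero}  {suc m} _         = s≤s (s≤s (s≤s (s≤s z≤n)))
4≤3+m∸k {suc k} {suc m} (s<s k<m) = 4≤3+m∸k k<m

⊛-den : ∀ (f : Series) m → (f ⊛ den) (3 + m) ≡ (f m +ℤ f (3 + m)) +ℤ - (+ 3 *ℤ f (2 + m))
⊛-den f m = begin
  sumℤ (map g (upTo (4 + m)))
    ≡⟨ peel ⟩
  (((sumℤ (map g (upTo m)) +ℤ g m) +ℤ g (1 + m)) +ℤ g (2 + m)) +ℤ g (3 + m)
    ≡⟨ cong (λ s → (((s +ℤ g m) +ℤ g (1 + m)) +ℤ g (2 + m)) +ℤ g (3 + m)) early-terms-vanish ⟩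
  (((+ 0 +ℤ g m) +ℤ g (1 + m)) +ℤ g (2 + m)) +ℤ g (3 + m)
    ≡⟨ last-terms ⟩
  (((+ 0 +ℤ f m *ℤ + 1) +ℤ f (1 + m) *ℤ + 0) +ℤ f (2 + m) *ℤ - + 3) +ℤ f (3 + m) *ℤ + 1
    ≡⟨ regroup (f m) (f (1 + m)) (f (2 + m)) (f (3 + m)) ⟩
  (f m +ℤ f (3 + m)) +ℤ - (+ 3 *ℤ f (2 + m))
    ∎
  where
  g : ℕ → ℤ
  g k = f k *ℤ den (3 + m ∸ k)
  peel : sumℤ (map g (upTo (4 + m))) ≡ (((sumℤ (map g (upTo m)) +ℤ g m) +ℤ g (1 + m)) +ℤ g (2 + m)) +ℤ g (3 + m)
  peel rewrite sumℤ-upTo-suc g (3 + m) | sumℤ-upTo-suc g (2 + m) | sumℤ-upTo-suc g (1 + m) | sumℤ-upTo-suc g m = refl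
  early-terms-vanish : sumℤ (map g (upTo m)) ≡ + 0
  early-terms-vanish = sumℤ-zero g (upTo m) λ {k} k∈ →
    trans (cong (f k *ℤ_) (den-vanishes (3 + m ∸ k) (4≤3+m∸k (∈-upTo⁻ k∈)))) (ℤ.*-zeroʳ (f k))
  last-terms : (((+ 0 +ℤ g m) +ℤ g (1 + m)) +ℤ g (2 + m)) +ℤ g (3 + m)
             ≡ (((+ 0 +ℤ f m *ℤ + 1) +ℤ f (1 + m) *ℤ + 0) +ℤ f (2 + m) *ℤ - + 3) +ℤ f (3 + m) *ℤ + 1
  last-terms rewrite m+n∸n≡m 3 m | m+n∸n≡m 2 m | m+n∸n≡m 1 m | n∸n≡0 m = refl
  regroup : ∀ a b c d → (((+ 0 +ℤ a *ℤ + 1) +ℤ b *ℤ + 0) +ℤ c *ℤ - + 3) +ℤ d *ℤ + 1 ≡ (a +ℤ d) +ℤ - (+ 3 *ℤ c)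
  regroup = ℤ-Solver.solve-∀

recurrence⇒ℤ : ∀ a b c → a + b ≡ 3 * c → (+ a +ℤ + b) +ℤ - (+ 3 *ℤ + c) ≡ + 0
recurrence⇒ℤ a b c a+b≡3c = begin
  (+ a +ℤ + b) +ℤ - (+ 3 *ℤ + c) ≡⟨ cong (λ z → + (a + b) +ℤ - z) (sym (ℤ.pos-* 3 c)) ⟩
  + (a + b) +ℤ - + (3 * c)       ≡⟨ cong (λ z → + z +ℤ - + (3 * c)) a+b≡3c ⟩
  + (3 * c) +ℤ - + (3 * c)       ≡⟨ ℤ.+-inverseʳ (+ (3 * c)) ⟩
  + 0                            ∎

theorem4p6 : ∀ n → ((λ k → + qbar Λ₄₆ k) ⊛ den) n ≡ num n
theorem4p6 0 = refl
theorem4p6 1 = refl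
theorem4p6 2 = refl
theorem4p6 3 = refl
theorem4p6 (suc (suc (suc (suc m)))) = begin
  (q ⊛ den) (3 + suc m)
    ≡⟨ ⊛-den q (suc m) ⟩
  (q (1 + m) +ℤ q (4 + m)) +ℤ - (+ 3 *ℤ q (3 + m))
    ≡⟨ recurrence⇒ℤ (q̄ (1 + m)) (q̄ (4 + m)) (q̄ (3 + m)) (qbar-recurrence m) ⟩
  + 0 ∎
  where
  q̄ : ℕ → ℕ
  q̄ = qbar Λ₄₆
  q : Series
  q k = + q̄ k
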